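{- Let $T$ be a tree of order $n$ with $\operatorname{diam}(T)\geq 3$. Then $\gamma_{t,coi}(T)=n-\beta(T)$ if and only if $T$ belongs to the family $\mathcal{T}$ consisting of the path $P_4$ together with all trees obtainable from $P_4$ by a finite sequence of the operations $O_1,O_2,O_3,O_4$ described below, where each operation is applied to the current tree $T'$: (O1) add a new vertex and join it to a vertex of $T'$ that belongs to some $\gamma_{t,coi}(T')$-set; (O2) add a new path $P_2$ and join one of its vertices to a vertex of $T'$ that belongs to some $\gamma_{t,coi}(T')$-set; (O3) add a new path $P_4=h_1u_1u_2h_2$ and join the leaf $h_1$ to a vertex $v$ of $T'$ that belongs to some $\gamma_{t,coi}(T')$-set; (O4) add a new path $P_4=h_1u_1u_2h_2$ and join the support vertex $u_1$ to a vertex $v$ of $T'$ that belongs to some maximum independent set of $T'$.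
   Context: All graphs are finite, simple and undirected. For a graph $G$, a set $D\subseteq V(G)$ is a total dominating set if every vertex of $G$ has at least one neighbor in $D$. A total dominating set $D$ is a total co-independent dominating set if $V(G)\setminus D$ is nonempty and independent. $\gamma_{t,coi}(G)$ is the minimum cardinality of a total co-independent dominating set of $G$; a $\gamma_{t,coi}(G)$-set is one of that cardinality. $\beta(G)$ is the maximum cardinality of an independent set of $G$. In a tree, a leaf is a vertex of degree one and a support vertex is a non-leaf vertex adjacent to a leaf. -}

module Defs where

import Data.Nat as ℕ
open import Data.Nat using (ℕ; _+_; _∸_; _≤_; _<_; _≡ᵇ_)
open import Data.Bool using (Bool; true; false; _∧_; _∨_)
open import Data.Fin using (Fin; zero; suc; toℕ; splitAt; _≟_)
open import Data.Fin.Subset using (Subset; _∈_; _∉_; ∣_∣)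
open import Data.Sum using (_⊎_; inj₁; inj₂)
open import Data.Product using (Σ; ∃; _×_; _,_)
open import Data.List using (List; []; _∷_; _++_; [_]; length)
open import Data.List.Relation.Unary.Linked using (Linked)
open import Data.List.Relation.Unary.Unique.Propositional using (Unique)
open import Function.Bundles using (_↔_; Inverse)
open import Relation.Nullary using (¬_)
open import Relation.Nullary.Decidable using (⌊_⌋)
open import Relation.Binary.PropositionalEquality using (_≡_)

record Graph (n : ℕ) : Set where
  field
    edge : Fin n → Fin n → Bool
open Graph public

Adj : ∀ {n} → Graph n → Fin n → Fin n → Set
Adj G u v = edge G u v ≡ true

IsSimple : ∀ {n} → Graph n → Set
IsSimple G = (∀ u v → Adj G u v → Adj G v u) × (∀ u → ¬ Adj G u u)

data Walk {n} (G : Graph n) : Fin n → Fin n → ℕ → Set where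
  nil  : ∀ {u} → Walk G u u 0
  cons : ∀ {u w v k} → Adj G u w → Walk G w v k → Walk G u v (ℕ.suc k)

Connected : ∀ {n} → Graph n → Set
Connected G = ∀ u v → ∃ λ k → Walk G u v k

HasCycle : ∀ {n} → Graph n → Set
HasCycle {n} G = Σ (Fin n) λ x → Σ (List (Fin n)) λ xs →
  (2 ≤ length xs) × Unique (x ∷ xs) × Linked (Adj G) (x ∷ xs ++ [ x ])

IsTree : ∀ {n} → Graph n → Set
IsTree G = IsSimple G × Connected G × ¬ HasCycle G

-- d(u,v) ≥ 3 : no walk of length < 3 from u to v
DistAtLeast3 : ∀ {n} → Graph n → Fin n → Fin n → Set
DistAtLeast3 G u v = ∀ k → k < 3 → ¬ Walk G u v k

DiamAtLeast3 : ∀ {n} → Graph n → Set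
DiamAtLeast3 {n} G = Σ (Fin n) λ u → Σ (Fin n) λ v → DistAtLeast3 G u v

IsTotalDominating : ∀ {n} → Graph n → Subset n → Set
IsTotalDominating G D = ∀ v → ∃ λ u → Adj G v u × u ∈ D

IsTCoIDominating : ∀ {n} → Graph n → Subset n → Set
IsTCoIDominating G D =
  IsTotalDominating G D
  × (∃ λ v → v ∉ D)
  × (∀ u v → u ∉ D → v ∉ D → ¬ Adj G u v)

IsGammaTCoISet : ∀ {n} → Graph n → Subset n → Set
IsGammaTCoISet G D =
  IsTCoIDominating G D × (∀ D′ → IsTCoIDominating G D′ → ∣ D ∣ ≤ ∣ D′ ∣)

IsGammaTCoI : ∀ {n} → Graph n → ℕ → Set
IsGammaTCoI G g = ∃ λ D → IsGammaTCoISet G D × ∣ D ∣ ≡ g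

IsIndependent : ∀ {n} → Graph n → Subset n → Set
IsIndependent G S = ∀ u v → u ∈ S → v ∈ S → ¬ Adj G u v

IsMaxIndependent : ∀ {n} → Graph n → Subset n → Set
IsMaxIndependent G S =
  IsIndependent G S × (∀ S′ → IsIndependent G S′ → ∣ S′ ∣ ≤ ∣ S ∣)

IsBeta : ∀ {n} → Graph n → ℕ → Set
IsBeta G b = ∃ λ S → IsMaxIndependent G S × ∣ S ∣ ≡ b

InSomeGammaSet : ∀ {n} → Graph n → Fin n → Set
InSomeGammaSet G v = ∃ λ D → IsGammaTCoISet G D × v ∈ D

InSomeMaxIndependentSet : ∀ {n} → Graph n → Fin n → Set
InSomeMaxIndependentSet G v = ∃ λ S → IsMaxIndependent G S × v ∈ S

pathGraph : (k : ℕ) → Graph k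
pathGraph k = record { edge = λ i j → (ℕ.suc (toℕ i) ≡ᵇ toℕ j) ∨ (ℕ.suc (toℕ j) ≡ᵇ toℕ i) }

eqb : ∀ {n} → Fin n → Fin n → Bool
eqb a b = ⌊ a ≟ b ⌋

-- disjoint union of G (vertices 0..n-1) and H (vertices n..n+k-1),
-- plus the single edge joining v ∈ G to h ∈ H
attach : ∀ {n k} → Graph n → Graph k → Fin n → Fin k → Graph (n + k)
attach {n} {k} G H v h = record { edge = e }
  where
  e : Fin (n + k) → Fin (n + k) → Bool
  e i j with splitAt n i | splitAt n j
  ... | inj₁ a | inj₁ b = edge G a b
  ... | inj₂ a | inj₂ b = edge H a b
  ... | inj₁ a | inj₂ b = eqb a v ∧ eqb b h
  ... | inj₂ a | inj₁ b = eqb b v ∧ eqb a h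

record Iso {n m} (G : Graph n) (H : Graph m) : Set where
  field
    bij : Fin n ↔ Fin m
    preserves : ∀ u v → edge G u v ≡ edge H (Inverse.to bij u) (Inverse.to bij v)

-- The family 𝒯 (closed under isomorphism)
-- O1: new vertex joined to a vertex of some γ_{t,coi}-set
-- O2: new P₂, one of its vertices joined to a vertex of some γ_{t,coi}-set
-- O3: new P₄ = h₁u₁u₂h₂ (vertices 0,1,2,3), leaf h₁ joined to such a vertex
-- O4: new P₄ = h₁u₁u₂h₂, support vertex u₁ joined to a vertex of some
--     maximum independent set
data InFamily : ∀ {n} → Graph n → Set where
  base : InFamily (pathGraph 4)
  iso  : ∀ {n m} {G : Graph n} {H : Graph m} → InFamily G → Iso G H → InFamily H
  O1   : ∀ {n} {G : Graph n} → InFamily G → (v : Fin n) → InSomeGammaSet G v →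
         InFamily (attach G (pathGraph 1) v zero)
  O2   : ∀ {n} {G : Graph n} → InFamily G → (v : Fin n) → InSomeGammaSet G v →
         InFamily (attach G (pathGraph 2) v zero)
  O3   : ∀ {n} {G : Graph n} → InFamily G → (v : Fin n) → InSomeGammaSet G v →
         InFamily (attach G (pathGraph 4) v zero)
  O4   : ∀ {n} {G : Graph n} → InFamily G → (v : Fin n) → InSomeMaxIndependentSet G v →
         InFamily (attach G (pathGraph 4) v (suc zero))

-- Pivot: a *good* maximum independent set is a nonempty maximum independent
-- set S such that every vertex has a neighbour outside S.  Complements of
-- good sets are exactly the γ_{t,coi}-sets of size n − β, so the equation says
-- that T has a good set, and "v lies in some γ_{t,coi}-set" becomes "v lies
-- outside some good set".  Soundness: P₄ has a good set, good sets transport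
-- along isomorphisms, and every operation O₁–O₄ extends a good set.
-- Completeness, by strong induction on the order: in a tree with a good set
-- S, leaves lie in S and supports outside S; along a locally maximal trail
-- x₀x₁x₂x₃… a case analysis at x₁, x₂, x₃ finds a pendant P₁, P₂ or P₄ attached
-- as in some Oᵢ (or T ≅ P₄, or S is not maximum); deleting it leaves a smaller
-- tree on which S restricts to a good set, and Oᵢ rebuilds T from it.

module Submission where

open import Defs
open import Data.Nat using (ℕ; zero; suc; _+_; _∸_; _≤_; _<_; z≤n; s≤s)
open import Data.Nat.Induction using (<-rec)
open import Data.Nat.Properties
  using ( module ≤-Reasoning; ≤-refl; ≤-trans; ≤-antisym; ≤-reflexive; <-irrefl; <-trans; <⇒≤
        ; m≤n⇒m≤1+n; m<m+n; +-suc; +-identityʳ; +-mono-≤; +-monoˡ-≤; +-cancelʳ-≤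
        ; ∸-monoʳ-≤; m∸[m∸n]≡n )
open import Data.Bool using (Bool; true; false; _∧_)
open import Data.Bool.Properties using () renaming (_≟_ to _≟b_)
open import Data.Fin using (Fin; zero; suc; _≟_; _↑ˡ_; _↑ʳ_; splitAt; join; punchIn; punchOut)
open import Data.Fin.Properties
  using ( any?; suc-injective; pigeonhole; punchOut-injective; punchIn-injective; punchInᵢ≢i
        ; punchIn-punchOut; splitAt-↑ˡ; splitAt-↑ʳ; join-splitAt; ↑ˡ-injective )
import Data.Fin.Properties as FP
open import Data.Fin.Subset using (Subset; _∈_; _∉_; ∣_∣; ∁)
open import Data.Fin.Subset.Properties
  using (x∈p⇒x∉∁p; x∈∁p⇒x∉p; x∉∁p⇒x∈p; x∉p⇒x∈∁p; ∣∁p∣≡n∸∣p∣; ∣p∣≤n)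
open import Data.Vec using ([]; _∷_; here; there; lookup; tabulate; replicate; _[_]≔_)
  renaming (_++_ to _++ᵛ_)
open import Data.Vec.Properties
  using ([]=⇒lookup; lookup⇒[]=; lookup∘update; lookup∘update′; lookup∘tabulate; tabulate∘lookup; lookup-++ˡ; lookup-++ʳ)
open import Data.List using (List; []; _∷_; _++_; [_]; length; map)
open import Data.List.Properties using (map-++; length-map)
open import Data.List.Relation.Unary.Linked using (Linked; []; [-]; _∷_)
open import Data.List.Relation.Unary.Unique.Propositional using (Unique)
import Data.List.Relation.Unary.Unique.Propositional.Properties as UP
open import Data.List.Relation.Unary.AllPairs using ([]; _∷_)
open import Data.List.Relation.Unary.All using (All; []; _∷_)
import Data.List.Relation.Unary.All.Properties as AllP
open import Data.List.Relation.Unary.Any using (Any; here; there)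
open import Data.Sum using (_⊎_; inj₁; inj₂; [_,_]′)
open import Data.Product using (Σ; ∃; ∃₂; _×_; _,_; proj₁; proj₂)
open import Data.Unit using (⊤; tt)
open import Data.Empty using (⊥; ⊥-elim)
open import Function.Base using (_∘_)
open import Function.Bundles using (_⇔_; Inverse; mk↔ₛ′; mk⇔)
open import Relation.Nullary using (¬_; Dec; yes; no)
open import Relation.Nullary.Decidable using (_×-dec_; ¬?)
open import Relation.Binary.PropositionalEquality
  using (_≡_; _≢_; refl; sym; trans; cong; cong₂; subst; subst₂; module ≡-Reasoning)

-- Subsets of Fin n are Boolean vectors; we reason with membership both as
-- x ∈ S and as the Boolean equation lookup S x ≡ true.

true≢false : true ≢ false
true≢false ()

In : ∀ {n} → Subset n → Fin n → Set
In S x = lookup S x ≡ true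

toIn : ∀ {n} {S : Subset n} {x} → x ∈ S → In S x
toIn = []=⇒lookup

fromIn : ∀ {n} {S : Subset n} {x} → In S x → x ∈ S
fromIn {S = S} {x} = lookup⇒[]= x S

∉⇒false : ∀ {n} {S : Subset n} {x} → x ∉ S → lookup S x ≡ false
∉⇒false {S = S} {x} h with lookup S x in eq
... | true = ⊥-elim (h (fromIn eq))
... | false = refl

false⇒∉ : ∀ {n} {S : Subset n} {x} → lookup S x ≡ false → x ∉ S
false⇒∉ e m with trans (sym e) (toIn m)
... | ()

card-upd-out : ∀ {n} (q : Subset n) z → In q z → ∣ q ∣ ≡ suc ∣ q [ z ]≔ false ∣
card-upd-out (true ∷ q) zero e = refl
card-upd-out (false ∷ q) zero ()
card-upd-out (true ∷ q) (suc z) e = cong suc (card-upd-out q z e)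
card-upd-out (false ∷ q) (suc z) e = card-upd-out q z e

card-upd-in : ∀ {n} (q : Subset n) z → lookup q z ≡ false → ∣ q [ z ]≔ true ∣ ≡ suc ∣ q ∣
card-upd-in (true ∷ q) zero ()
card-upd-in (false ∷ q) zero e = refl
card-upd-in (true ∷ q) (suc z) e = cong suc (card-upd-in q z e)
card-upd-in (false ∷ q) (suc z) e = card-upd-in q z e

lookup-upd-same : ∀ {n} (q : Subset n) z b → lookup (q [ z ]≔ b) z ≡ b
lookup-upd-same q z b = lookup∘update z q b

lookup-upd-other : ∀ {n} (q : Subset n) z y b → y ≢ z → lookup (q [ z ]≔ b) y ≡ lookup q y
lookup-upd-other q z y b y≢z = lookup∘update′ y≢z q b

card-≤-injection : ∀ {n m} (p : Subset n) (q : Subset m) (f : Fin n → Fin m) →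
  (∀ x y → f x ≡ f y → x ≡ y) → (∀ x → In p x → In q (f x)) → ∣ p ∣ ≤ ∣ q ∣
card-≤-injection [] q f inj mp = z≤n
card-≤-injection (false ∷ p) q f inj mp = card-≤-injection p q (λ x → f (suc x)) (λ x y e → suc-injective (inj _ _ e)) (λ x → mp (suc x))
card-≤-injection {suc n} {m} (true ∷ p) q f inj mp =
  subst (λ t → suc ∣ p ∣ ≤ t) (sym (card-upd-out q (f zero) (mp zero refl))) (s≤s rec)
  where
  rec : ∣ p ∣ ≤ ∣ q [ f zero ]≔ false ∣
  rec = card-≤-injection p (q [ f zero ]≔ false) (λ x → f (suc x)) (λ x y e → suc-injective (inj _ _ e))
    (λ x px → trans (lookup-upd-other q (f zero) (f (suc x)) false (suc≢zero ∘ inj _ _)) (mp (suc x) px))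
    where
    suc≢zero : ∀ {x : Fin n} → suc x ≢ zero
    suc≢zero ()

card-++ : ∀ {n k} (p : Subset n) (q : Subset k) → ∣ p ++ᵛ q ∣ ≡ ∣ p ∣ + ∣ q ∣
card-++ [] q = refl
card-++ (true ∷ p) q = cong suc (card-++ p q)
card-++ (false ∷ p) q = card-++ p q

-- Every vertex has a neighbour outside S (so that the complement of S is a
-- total dominating set).
OutsideNeighbour : ∀ {n} → Graph n → Subset n → Set
OutsideNeighbour G S = ∀ v → ∃ λ u → Adj G v u × lookup S u ≡ false

-- A good maximum independent set: maximum independent, nonempty, and with an
-- outside neighbour for every vertex.  Its complement is a γ_{t,coi}-set.
GoodMIS : ∀ {n} → Graph n → Subset n → Set
GoodMIS G S = IsMaxIndependent G S × OutsideNeighbour G S × ∃ (In S)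

HasGoodMIS : ∀ {n} → Graph n → Set
HasGoodMIS G = ∃ (GoodMIS G)

-- A maximum independent set is maximal: every vertex outside it has a
-- neighbour inside it, since otherwise adding the vertex would enlarge it.
maximum⇒maximal : ∀ {n} (G : Graph n) (S : Subset n) → IsSimple G → IsMaxIndependent G S →
  ∀ i → lookup S i ≡ false → ∃ λ u → Adj G i u × In S u
maximum⇒maximal G S (sy , irr) (ind , mx) i out with any? (λ u → (edge G i u ≟b true) ×-dec (lookup S u ≟b true))
... | yes w = w
... | no nw = ⊥-elim (<-irrefl refl (subst (_≤ ∣ S ∣) (card-upd-in S i out) (mx S' ind')))
  where
  S' = S [ i ]≔ true
  memS' : ∀ u → u ∈ S' → u ≡ i ⊎ u ∈ S
  memS' u m with u ≟ i
  ... | yes e = inj₁ e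
  ... | no ne = inj₂ (fromIn (trans (sym (lookup-upd-other S i u true ne)) (toIn m)))
  ind' : IsIndependent G S'
  ind' u v mu mv a with memS' u mu | memS' v mv
  ... | inj₁ refl | inj₁ refl = irr u a
  ... | inj₁ refl | inj₂ q = nw (v , a , toIn q)
  ... | inj₂ p | inj₁ refl = nw (u , sy u v a , toIn p)
  ... | inj₂ p | inj₂ q = ind u v p q a

inComplement : ∀ {n} {S : Subset n} {u} → lookup S u ≡ false → u ∈ ∁ S
inComplement f = x∉p⇒x∈∁p (false⇒∉ f)

complement-independent : ∀ {n} (G : Graph n) D → IsTCoIDominating G D → IsIndependent G (∁ D)
complement-independent G D (_ , _ , coind) a b a∈ b∈ = coind a b (x∈∁p⇒x∉p a∈) (x∈∁p⇒x∉p b∈)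

tcoi-lower-bound : ∀ {n} (G : Graph n) S D → IsMaxIndependent G S → IsTCoIDominating G D →
  n ∸ ∣ S ∣ ≤ ∣ D ∣
tcoi-lower-bound {n} G S D (_ , maximum) tc = begin
  n ∸ ∣ S ∣        ≤⟨ ∸-monoʳ-≤ n (maximum (∁ D) (complement-independent G D tc)) ⟩
  n ∸ ∣ ∁ D ∣      ≡⟨ cong (n ∸_) (∣∁p∣≡n∸∣p∣ D) ⟩
  n ∸ (n ∸ ∣ D ∣)  ≡⟨ m∸[m∸n]≡n (∣p∣≤n D) ⟩
  ∣ D ∣            ∎
  where open ≤-Reasoning

-- The complement of a good set attains this bound, so it is a γ_{t,coi}-set.
goodMIS-complement-γ : ∀ {n} (G : Graph n) S → GoodMIS G S → IsGammaTCoISet G (∁ S)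
goodMIS-complement-γ G S (max , outside , (v , v∈S)) = tcoi , minimum
  where
  tcoi : IsTCoIDominating G (∁ S)
  tcoi = (λ w → let (u , w~u , u∉S) = outside w in u , w~u , inComplement u∉S)
       , (v , x∈p⇒x∉∁p (fromIn v∈S))
       , (λ a b a∉ b∉ → proj₁ max a b (x∉∁p⇒x∈p a∉) (x∉∁p⇒x∈p b∉))
  minimum : ∀ D′ → IsTCoIDominating G D′ → ∣ ∁ S ∣ ≤ ∣ D′ ∣
  minimum D′ tc = subst (_≤ ∣ D′ ∣) (sym (∣∁p∣≡n∸∣p∣ S)) (tcoi-lower-bound G S D′ max tc)

goodMIS⇒equality : ∀ {n} (G : Graph n) → HasGoodMIS G →
  Σ ℕ λ g → Σ ℕ λ b → IsGammaTCoI G g × IsBeta G b × g ≡ n ∸ b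
goodMIS⇒equality G (S , good) =
  ∣ ∁ S ∣ , ∣ S ∣ , (∁ S , goodMIS-complement-γ G S good , refl) , (S , proj₁ good , refl) , ∣∁p∣≡n∸∣p∣ S

tcoi-complement-goodMIS : ∀ {n} (G : Graph n) D S → IsTCoIDominating G D → IsMaxIndependent G S →
  ∣ S ∣ ≤ ∣ ∁ D ∣ → GoodMIS G (∁ D)
tcoi-complement-goodMIS G D S tc@(td , (v , v∉D) , _) (_ , maximum) S≤∁D =
  (complement-independent G D tc , (λ S′ i → ≤-trans (maximum S′ i) S≤∁D))
  , (λ w → let (u , w~u , u∈D) = td w in u , w~u , ∉⇒false (x∈p⇒x∉∁p u∈D))
  , (v , toIn (x∉p⇒x∈∁p v∉D))

equality⇒goodMIS : ∀ {n} (G : Graph n) →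
  (Σ ℕ λ g → Σ ℕ λ b → IsGammaTCoI G g × IsBeta G b × g ≡ n ∸ b) → HasGoodMIS G
equality⇒goodMIS {n} G (g , b , (D , (tc , _) , ∣D∣≡g) , (S , max , ∣S∣≡b) , g≡n∸b) =
  ∁ D , tcoi-complement-goodMIS G D S tc max (≤-reflexive (sym complement-size))
  where
  complement-size : ∣ ∁ D ∣ ≡ ∣ S ∣
  complement-size = begin
    ∣ ∁ D ∣      ≡⟨ ∣∁p∣≡n∸∣p∣ D ⟩
    n ∸ ∣ D ∣    ≡⟨ cong (n ∸_) (trans ∣D∣≡g g≡n∸b) ⟩
    n ∸ (n ∸ b)  ≡⟨ m∸[m∸n]≡n (subst (_≤ n) ∣S∣≡b (∣p∣≤n S)) ⟩
    b            ≡⟨ sym ∣S∣≡b ⟩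
    ∣ S ∣        ∎
    where open ≡-Reasoning

γ-complement-goodMIS : ∀ {n} (G : Graph n) S D → GoodMIS G S → IsGammaTCoISet G D → GoodMIS G (∁ D)
γ-complement-goodMIS {n} G S D good (tc , minimum) = tcoi-complement-goodMIS G D S tc (proj₁ good) S≤∁D
  where
  D≤ : ∣ D ∣ ≤ n ∸ ∣ S ∣
  D≤ = subst (∣ D ∣ ≤_) (∣∁p∣≡n∸∣p∣ S) (minimum (∁ S) (proj₁ (goodMIS-complement-γ G S good)))
  S≤∁D : ∣ S ∣ ≤ ∣ ∁ D ∣
  S≤∁D = begin
    ∣ S ∣            ≡⟨ sym (m∸[m∸n]≡n (∣p∣≤n S)) ⟩
    n ∸ (n ∸ ∣ S ∣)  ≤⟨ ∸-monoʳ-≤ n D≤ ⟩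
    n ∸ ∣ D ∣        ≡⟨ sym (∣∁p∣≡n∸∣p∣ D) ⟩
    ∣ ∁ D ∣          ∎
    where open ≤-Reasoning

outside⇒inSomeγ : ∀ {n} (G : Graph n) S v → GoodMIS G S → lookup S v ≡ false → InSomeGammaSet G v
outside⇒inSomeγ G S v good v∉S = ∁ S , goodMIS-complement-γ G S good , inComplement v∉S

inSomeγ⇒outside : ∀ {n} (G : Graph n) v → HasGoodMIS G → InSomeGammaSet G v →
  ∃ λ S′ → GoodMIS G S′ × lookup S′ v ≡ false
inSomeγ⇒outside G v (S , good) (D , γ , v∈D) = ∁ D , γ-complement-goodMIS G S D good γ , ∉⇒false (x∈p⇒x∉∁p v∈D)

restrict : ∀ {n m} → (Fin m → Fin n) → Subset n → Subset m
restrict φ S = tabulate (λ a → lookup S (φ a))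

restrict-lookup : ∀ {n m} (φ : Fin m → Fin n) S a → lookup (restrict φ S) a ≡ lookup S (φ a)
restrict-lookup φ S a = lookup∘tabulate (λ a → lookup S (φ a)) a

restrict-independent : ∀ {n m} {G : Graph n} {H : Graph m} (φ : Fin m → Fin n) →
  (∀ a b → Adj H a b → Adj G (φ a) (φ b)) → ∀ S → IsIndependent G S → IsIndependent H (restrict φ S)
restrict-independent φ φ-adj S ind a b a∈ b∈ a~b =
  ind (φ a) (φ b) (fromIn (trans (sym (restrict-lookup φ S a)) (toIn a∈)))
                  (fromIn (trans (sym (restrict-lookup φ S b)) (toIn b∈))) (φ-adj a b a~b)

linkMap : ∀ {n m} {G : Graph n} {H : Graph m} (f : Fin n → Fin m) → (∀ a b → Adj G a b → Adj H (f a) (f b)) →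
  ∀ {l} → Linked (Adj G) l → Linked (Adj H) (map f l)
linkMap f af [] = []
linkMap f af [-] = [-]
linkMap f af (a ∷ l) = af _ _ a ∷ linkMap f af l

cycle-map : ∀ {n m} {G : Graph n} {H : Graph m} (f : Fin n → Fin m) → (∀ x y → f x ≡ f y → x ≡ y) →
  (∀ a b → Adj G a b → Adj H (f a) (f b)) → HasCycle G → HasCycle H
cycle-map f inj af (x , xs , len , un , lk) =
  f x , map f xs , subst (2 ≤_) (sym (length-map f xs)) len ,
  UP.map⁺ (λ {a} {b} → inj a b) un ,
  subst (Linked (Adj _)) (cong (f x ∷_) (map-++ f xs [ x ])) (linkMap f af lk)

module Transport {n m} (G : Graph n) (H : Graph m) (f : Fin n → Fin m) (g : Fin m → Fin n)
  (fg : ∀ y → f (g y) ≡ y) (gf : ∀ x → g (f x) ≡ x)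
  (pres : ∀ u v → edge G u v ≡ edge H (f u) (f v)) where

  pres' : ∀ a b → edge H a b ≡ edge G (g a) (g b)
  pres' a b = trans (cong₂ (edge H) (sym (fg a)) (sym (fg b))) (sym (pres (g a) (g b)))

  f-inj : ∀ x y → f x ≡ f y → x ≡ y
  f-inj x y e = trans (sym (gf x)) (trans (cong g e) (gf y))

  g-inj : ∀ x y → g x ≡ g y → x ≡ y
  g-inj x y e = trans (sym (fg x)) (trans (cong f e) (fg y))

  -- Subsets are pushed forward along f by pulling back along g, and back again.
  push : Subset n → Subset m
  push = restrict g

  push-lookup : ∀ S y → lookup (push S) y ≡ lookup S (g y)
  push-lookup = restrict-lookup g

  push-lookup′ : ∀ S x → lookup (push S) (f x) ≡ lookup S x
  push-lookup′ S x = trans (push-lookup S (f x)) (cong (lookup S) (gf x))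

  pull : Subset m → Subset n
  pull = restrict f

  pull-lookup : ∀ S x → lookup (pull S) x ≡ lookup S (f x)
  pull-lookup = restrict-lookup f

  card-push : ∀ S → ∣ push S ∣ ≡ ∣ S ∣
  card-push S = ≤-antisym
    (card-≤-injection (push S) S g g-inj (λ y e → trans (sym (push-lookup S y)) e))
    (card-≤-injection S (push S) f f-inj (λ x e → trans (push-lookup′ S x) e))

  card-pull : ∀ S → ∣ pull S ∣ ≡ ∣ S ∣
  card-pull S = ≤-antisym
    (card-≤-injection (pull S) S f f-inj (λ x e → trans (sym (pull-lookup S x)) e))
    (card-≤-injection S (pull S) g g-inj (λ y e → trans (pull-lookup S (g y)) (trans (cong (lookup S) (fg y)) e)))

  adjGH : ∀ u v → Adj G u v → Adj H (f u) (f v)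
  adjGH u v a = trans (sym (pres u v)) a

  adjHG : ∀ a b → Adj H a b → Adj G (g a) (g b)
  adjHG a b e = trans (sym (pres' a b)) e

  adjGH' : ∀ a b → Adj G (g a) (g b) → Adj H a b
  adjGH' a b e = trans (pres' a b) e

  goodMIS-transport : ∀ S → GoodMIS G S → GoodMIS H (push S)
  goodMIS-transport S ((ind , mx) , gd , (v , vin)) =
    (restrict-independent g adjHG S ind , mx') , gd' , (f v , trans (push-lookup′ S v) vin)
    where
    mx' : ∀ S′ → IsIndependent H S′ → ∣ S′ ∣ ≤ ∣ push S ∣
    mx' S′ i = subst₂ _≤_ (card-pull S′) (sym (card-push S)) (mx (pull S′) (restrict-independent f adjGH S′ i))
    gd' : OutsideNeighbour H (push S)
    gd' y = let (u , a , o) = gd (g y) in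
      f u , adjGH' y (f u) (subst (λ t → Adj G (g y) t) (sym (gf u)) a) , trans (push-lookup′ S u) o

  walkGH : ∀ {u v k} → Walk G u v k → Walk H (f u) (f v) k
  walkGH nil = nil
  walkGH (cons a w) = cons (adjGH _ _ a) (walkGH w)

  tree-transport : IsTree G → IsTree H
  tree-transport ((sy , irr) , con , acyc) = (sy' , irr') , con' , acyc'
    where
    sy' : ∀ a b → Adj H a b → Adj H b a
    sy' a b e = adjGH' b a (sy (g a) (g b) (adjHG a b e))
    irr' : ∀ a → ¬ Adj H a a
    irr' a e = irr (g a) (adjHG a a e)
    con' : Connected H
    con' a b = let (k , w) = con (g a) (g b) in k , subst₂ (λ x y → Walk H x y k) (fg a) (fg b) (walkGH w)
    acyc' : ¬ HasCycle H
    acyc' c = acyc (cycle-map g g-inj adjHG c)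

module IsoTransport {n m} {G : Graph n} {H : Graph m} (I : Iso G H) where
  open Iso I
  open Inverse bij
  open Transport G H to from strictlyInverseˡ strictlyInverseʳ preserves public

goodMIS-iso : ∀ {n m} {G : Graph n} {H : Graph m} → Iso G H → HasGoodMIS G → HasGoodMIS H
goodMIS-iso I (S , gm) = IsoTransport.push I S , IsoTransport.goodMIS-transport I S gm

tree-iso : ∀ {n m} {G : Graph n} {H : Graph m} → Iso G H → IsTree G → IsTree H
tree-iso I = IsoTransport.tree-transport I

eqb-refl : ∀ {n} (a : Fin n) → eqb a a ≡ true
eqb-refl a with a ≟ a
... | yes _ = refl
... | no ne = ⊥-elim (ne refl)

eqb-sound : ∀ {n} (a b : Fin n) → eqb a b ≡ true → a ≡ b
eqb-sound a b e with a ≟ b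
... | yes p = p
eqb-sound a b () | no _

∧-l : ∀ {x y} → x ∧ y ≡ true → x ≡ true
∧-l {true} e = refl
∧-r : ∀ {x y} → x ∧ y ≡ true → y ≡ true
∧-r {true} e = e

card-splitAt : ∀ n {k} (S : Subset (n + k)) →
  ∣ S ∣ ≡ ∣ tabulate (λ a → lookup S (a ↑ˡ k)) ∣ + ∣ tabulate (λ j → lookup S (n ↑ʳ j)) ∣
card-splitAt zero S = cong ∣_∣ (sym (tabulate∘lookup S))
card-splitAt (suc n) (true ∷ S) = cong suc (card-splitAt n S)
card-splitAt (suc n) (false ∷ S) = card-splitAt n S

module Blocks (n k : ℕ) where
  L : Fin n → Fin (n + k)
  L a = a ↑ˡ k
  R : Fin k → Fin (n + k)
  R j = n ↑ʳ j

  data View : Fin (n + k) → Set where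
    isL : ∀ a → View (L a)
    isR : ∀ j → View (R j)

  view : ∀ x → View x
  view x = subst View (join-splitAt n k x) (view' (splitAt n x))
    where
    view' : ∀ s → View (join n k s)
    view' (inj₁ a) = isL a
    view' (inj₂ j) = isR j

  L≢R : ∀ a j → L a ≢ R j
  L≢R a j e with trans (sym (splitAt-↑ˡ n a k)) (trans (cong (splitAt n) e) (splitAt-↑ʳ n k j))
  ... | ()

  L-inj : ∀ a b → L a ≡ L b → a ≡ b
  L-inj a b = ↑ˡ-injective k a b

module Attach {n k} (G : Graph n) (H : Graph k) (v : Fin n) (h : Fin k) where
  A : Graph (n + k)
  A = attach G H v h

  open Blocks n k public

  eLL : ∀ a b → edge A (L a) (L b) ≡ edge G a b
  eLL a b rewrite splitAt-↑ˡ n a k | splitAt-↑ˡ n b k = refl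
  eRR : ∀ a b → edge A (R a) (R b) ≡ edge H a b
  eRR a b rewrite splitAt-↑ʳ n k a | splitAt-↑ʳ n k b = refl
  eLR : ∀ a b → edge A (L a) (R b) ≡ eqb a v ∧ eqb b h
  eLR a b rewrite splitAt-↑ˡ n a k | splitAt-↑ʳ n k b = refl
  eRL : ∀ a b → edge A (R a) (L b) ≡ eqb b v ∧ eqb a h
  eRL a b rewrite splitAt-↑ʳ n k a | splitAt-↑ˡ n b k = refl

  LR-v : ∀ a b → Adj A (L a) (R b) → a ≡ v × b ≡ h
  LR-v a b e = let e' = trans (sym (eLR a b)) e in eqb-sound a v (∧-l e') , eqb-sound b h (∧-r e')
  RL-v : ∀ a b → Adj A (R a) (L b) → b ≡ v × a ≡ h
  RL-v a b e = let e' = trans (sym (eRL a b)) e in eqb-sound b v (∧-l e') , eqb-sound a h (∧-r e')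

  adjRL : Adj A (R h) (L v)
  adjRL = trans (eRL h v) (cong₂ _∧_ (eqb-refl v) (eqb-refl h))

  adjL : ∀ a b → Adj G a b → Adj A (L a) (L b)
  adjL a b e = trans (eLL a b) e
  adjL' : ∀ a b → Adj A (L a) (L b) → Adj G a b
  adjL' a b e = trans (sym (eLL a b)) e
  adjR : ∀ a b → Adj H a b → Adj A (R a) (R b)
  adjR a b e = trans (eRR a b) e
  adjR' : ∀ a b → Adj A (R a) (R b) → Adj H a b
  adjR' a b e = trans (sym (eRR a b)) e

  SL : Subset (n + k) → Subset n
  SL = restrict L
  SR : Subset (n + k) → Subset k
  SR = restrict R
  SL-lk : ∀ S a → lookup (SL S) a ≡ lookup S (L a)
  SL-lk = restrict-lookup L

  card-split : ∀ S → ∣ S ∣ ≡ ∣ SL S ∣ + ∣ SR S ∣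
  card-split S = card-splitAt n S

  ++L : ∀ (P : Subset n) (Q : Subset k) a → lookup (P ++ᵛ Q) (L a) ≡ lookup P a
  ++L P Q a = lookup-++ˡ P Q a
  ++R : ∀ (P : Subset n) (Q : Subset k) j → lookup (P ++ᵛ Q) (R j) ≡ lookup Q j
  ++R P Q j = lookup-++ʳ P Q j

  indep++ : ∀ P Q → IsIndependent G P → IsIndependent H Q → (In Q h → lookup P v ≡ false) →
    IsIndependent A (P ++ᵛ Q)
  indep++ P Q iP iQ c x y mx my e with view x | view y
  ... | isL a | isL b = iP a b (fromIn (trans (sym (++L P Q a)) (toIn mx)))
                            (fromIn (trans (sym (++L P Q b)) (toIn my))) (adjL' a b e)
  ... | isR a | isR b = iQ a b (fromIn (trans (sym (++R P Q a)) (toIn mx)))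
                            (fromIn (trans (sym (++R P Q b)) (toIn my))) (adjR' a b e)
  ... | isL a | isR b with LR-v a b e
  ... | refl , refl with trans (sym (c (trans (sym (++R P Q h)) (toIn my)))) (trans (sym (++L P Q v)) (toIn mx))
  ... | ()
  indep++ P Q iP iQ c x y mx my e | isR a | isL b with RL-v a b e
  ... | refl , refl with trans (sym (c (trans (sym (++R P Q h)) (toIn mx)))) (trans (sym (++L P Q v)) (toIn my))
  ... | ()

  indepSL : ∀ S → IsIndependent A S → IsIndependent G (SL S)
  indepSL = restrict-independent L adjL
  indepSR : ∀ S → IsIndependent A S → IsIndependent H (SR S)
  indepSR = restrict-independent R adjR

  -- Soundness of one operation: a good set S of G and a maximum independent
  -- set Q of H combine to a good set of A, provided the attaching edge is not
  -- inside S ++ᵛ Q and every vertex of H has a neighbour outside Q, except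
  -- possibly h when v ∉ S (then v is that neighbour).
  attach-goodMIS : ∀ S Q → GoodMIS G S → IsIndependent H Q → (∀ Q′ → IsIndependent H Q′ → ∣ Q′ ∣ ≤ ∣ Q ∣) →
    (In Q h → lookup S v ≡ false) →
    (∀ j → (∃ λ j′ → Adj H j j′ × lookup Q j′ ≡ false) ⊎ (j ≡ h × lookup S v ≡ false)) →
    GoodMIS A (S ++ᵛ Q)
  attach-goodMIS S Q ((iS , mS) , gS , (w , wS)) iQ mQ c gQ =
    (indep++ S Q iS iQ c , mx) , gd , (L w , trans (++L S Q w) wS)
    where
    mx : ∀ S′ → IsIndependent A S′ → ∣ S′ ∣ ≤ ∣ S ++ᵛ Q ∣
    mx S′ i = subst₂ _≤_ (sym (card-split S′)) (sym (card-++ S Q))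
                (+-mono-≤ (mS (SL S′) (indepSL S′ i)) (mQ (SR S′) (indepSR S′ i)))
    gd : OutsideNeighbour A (S ++ᵛ Q)
    gd x with view x
    ... | isL a = let (u , e , o) = gS a in L u , adjL a u e , trans (++L S Q u) o
    ... | isR j with gQ j
    ... | inj₁ (j′ , e , o) = R j′ , adjR j j′ e , trans (++R S Q j′) o
    ... | inj₂ (refl , o) = L v , adjRL , trans (++L S Q v) o

  -- Completeness of one step: the trace on G of a good set S of A is good,
  -- provided (i) H has a maximum independent set Q′ and every independent set
  -- of G can be enlarged to one compatible with Q′ across the attaching edge
  -- (so ∣ SL S ∣ is maximum), and (ii) v keeps a neighbour in G outside S, or
  -- at least some neighbour in G when v ∈ S.
  restrict-goodMIS : ∀ S → IsSimple A → GoodMIS A S → (Q′ : Subset k) → IsIndependent H Q′ →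
    (∀ Q″ → IsIndependent H Q″ → ∣ Q″ ∣ ≤ ∣ Q′ ∣) →
    (∀ I → IsIndependent G I → ∃ λ I′ → IsIndependent G I′ × ∣ I ∣ ≤ ∣ I′ ∣ × (In Q′ h → lookup I′ v ≡ false)) →
    (lookup S (L v) ≡ false → ∃ λ u → Adj G v u × lookup S (L u) ≡ false) →
    (lookup S (L v) ≡ true → ∃ λ u → Adj G v u) →
    GoodMIS G (SL S)
  restrict-goodMIS S simp ((iS , mS) , gS , _) Q′ iQ mQ swap r3 r4 =
    (indepSL S iS , mx) , gd , ne
    where
    mx : ∀ I → IsIndependent G I → ∣ I ∣ ≤ ∣ SL S ∣
    mx I iI with swap I iI
    ... | I′ , iI′ , le , c = ≤-trans le (+-cancelʳ-≤ (∣ Q′ ∣) (∣ I′ ∣) (∣ SL S ∣) bound)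
      where
      b1 : ∣ I′ ++ᵛ Q′ ∣ ≤ ∣ S ∣
      b1 = mS (I′ ++ᵛ Q′) (indep++ I′ Q′ iI′ iQ c)
      bound : ∣ I′ ∣ + ∣ Q′ ∣ ≤ ∣ SL S ∣ + ∣ Q′ ∣
      bound = ≤-trans (subst (_≤ ∣ S ∣) (card-++ I′ Q′) b1)
               (subst (_≤ ∣ SL S ∣ + ∣ Q′ ∣) (sym (card-split S))
                 (+-mono-≤ (≤-refl {∣ SL S ∣}) (mQ (SR S) (indepSR S iS))))
    vcase : ∃ λ u → Adj G v u × lookup (SL S) u ≡ false
    vcase with lookup S (L v) in eq
    ... | false = let (u , e , o) = r3 refl in u , e , trans (SL-lk S u) o
    ... | true with r4 refl
    ... | u , e with lookup S (L u) in eu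
    ... | false = u , e , trans (SL-lk S u) eu
    ... | true = ⊥-elim (iS (L v) (L u) (fromIn eq) (fromIn eu) (adjL v u e))
    gd : OutsideNeighbour G (SL S)
    gd a with gS (L a)
    ... | x , e , o with view x
    ... | isL u = u , adjL' a u e , trans (SL-lk S u) o
    ... | isR j with LR-v a j e
    ... | refl , _ = vcase
    ne : ∃ (In (SL S))
    ne with lookup S (L v) in eq
    ... | true = v , trans (SL-lk S v) eq
    ... | false with r3 refl
    ... | u , e , o with maximum⇒maximal A S simp (iS , mS) (L u) o
    ... | y , ey , yin with view y
    ... | isL w = w , trans (SL-lk S w) yin
    ... | isR j with LR-v u j ey
    ... | refl , _ = ⊥-elim (proj₂ simp (L u) (adjL u u e))

  -- Walks of A between vertices of G can be shortened to walks of G: an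
  -- excursion into H must leave through h and return to v.
  leave-pendant : ∀ {x y m} → Walk A x y m → ∀ j b → x ≡ R j → y ≡ L b → ∃ λ m′ → m′ < m × Walk A (L v) (L b) m′
  leave-pendant nil j b refl e = ⊥-elim (L≢R b j (sym e))
  leave-pendant (cons {w = w} a wk) j b refl refl with view w
  ... | isR j′ = let (m′ , lt , wk′) = leave-pendant wk j′ b refl refl in m′ , m≤n⇒m≤1+n lt , wk′
  ... | isL u with RL-v j u a
  ... | refl , _ = _ , ≤-refl , wk

  restrict-walk : ∀ fuel {m a b} → m < fuel → Walk A (L a) (L b) m → ∃ λ m′ → Walk G a b m′
  restrict-walk zero () _
  restrict-walk (suc fuel) lt wk = go lt wk refl refl
    where
    go : ∀ {m x y a b} → m < suc fuel → Walk A x y m → x ≡ L a → y ≡ L b → ∃ λ m′ → Walk G a b m′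
    go {a = a} {b} lt nil e1 e2 with L-inj a b (trans (sym e1) e2)
    ... | refl = 0 , nil
    go {a = a} {b} (s≤s lt) (cons {w = w} e wk) refl refl with view w
    ... | isL u = let (m′ , wk′) = restrict-walk fuel lt wk in suc m′ , cons (adjL' a u e) wk′
    ... | isR j with LR-v a j e
    ... | refl , _ = let (m₁ , lt₁ , wk₁) = leave-pendant wk j b refl refl in restrict-walk fuel (<-trans lt₁ lt) wk₁

  tree-restrict : IsTree A → IsTree G
  tree-restrict ((sy , irr) , con , acyc) = (sy' , irr') , con' , acyc'
    where
    sy' : ∀ a b → Adj G a b → Adj G b a
    sy' a b e = adjL' b a (sy (L a) (L b) (adjL a b e))
    irr' : ∀ a → ¬ Adj G a a
    irr' a e = irr (L a) (adjL a a e)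
    con' : Connected G
    con' a b = let (m , wk) = con (L a) (L b) in restrict-walk (suc m) ≤-refl wk
    acyc' : ¬ HasCycle G
    acyc' c = acyc (cycle-map L (λ x y → L-inj x y) adjL c)

P4-independent≤2 : ∀ Q → IsIndependent (pathGraph 4) Q → ∣ Q ∣ ≤ 2
P4-independent≤2 (true ∷ true ∷ true ∷ true ∷ []) i = ⊥-elim (i (zero) (suc zero) (here) (there (here)) refl)
P4-independent≤2 (true ∷ true ∷ true ∷ false ∷ []) i = ⊥-elim (i (zero) (suc zero) (here) (there (here)) refl)
P4-independent≤2 (true ∷ true ∷ false ∷ true ∷ []) i = ⊥-elim (i (zero) (suc zero) (here) (there (here)) refl)
P4-independent≤2 (true ∷ true ∷ false ∷ false ∷ []) i = s≤s (s≤s (z≤n))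
P4-independent≤2 (true ∷ false ∷ true ∷ true ∷ []) i = ⊥-elim (i (suc (suc zero)) (suc (suc (suc zero))) (there (there (here))) (there (there (there (here)))) refl)
P4-independent≤2 (true ∷ false ∷ true ∷ false ∷ []) i = s≤s (s≤s (z≤n))
P4-independent≤2 (true ∷ false ∷ false ∷ true ∷ []) i = s≤s (s≤s (z≤n))
P4-independent≤2 (true ∷ false ∷ false ∷ false ∷ []) i = s≤s (z≤n)
P4-independent≤2 (false ∷ true ∷ true ∷ true ∷ []) i = ⊥-elim (i (suc zero) (suc (suc zero)) (there (here)) (there (there (here))) refl)
P4-independent≤2 (false ∷ true ∷ true ∷ false ∷ []) i = s≤s (s≤s (z≤n))
P4-independent≤2 (false ∷ true ∷ false ∷ true ∷ []) i = s≤s (s≤s (z≤n))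
P4-independent≤2 (false ∷ true ∷ false ∷ false ∷ []) i = s≤s (z≤n)
P4-independent≤2 (false ∷ false ∷ true ∷ true ∷ []) i = s≤s (s≤s (z≤n))
P4-independent≤2 (false ∷ false ∷ true ∷ false ∷ []) i = s≤s (z≤n)
P4-independent≤2 (false ∷ false ∷ false ∷ true ∷ []) i = s≤s (z≤n)
P4-independent≤2 (false ∷ false ∷ false ∷ false ∷ []) i = z≤n

P2-independent≤1 : ∀ Q → IsIndependent (pathGraph 2) Q → ∣ Q ∣ ≤ 1
P2-independent≤1 (true ∷ true ∷ []) i = ⊥-elim (i zero (suc zero) here (there here) refl)
P2-independent≤1 (true ∷ false ∷ []) i = s≤s z≤n
P2-independent≤1 (false ∷ true ∷ []) i = s≤s z≤n
P2-independent≤1 (false ∷ false ∷ []) i = z≤n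

-- Maximum independent sets of the attached paths: the two leaves of P₄, the
-- far end of P₂ (vertex 0 is the attaching vertex), the single vertex of P₁.
Q4 : Subset 4
Q4 = true ∷ false ∷ false ∷ true ∷ []
Q2 : Subset 2
Q2 = false ∷ true ∷ []
Q1 : Subset 1
Q1 = true ∷ []

Q4-ind : IsIndependent (pathGraph 4) Q4
Q4-ind _ _ here here ()
Q4-ind _ _ here (there (there (there here))) ()
Q4-ind _ _ (there (there (there here))) here ()
Q4-ind _ _ (there (there (there here))) (there (there (there here))) ()

Q2-ind : IsIndependent (pathGraph 2) Q2
Q2-ind _ _ (there here) (there here) ()

Q1-ind : IsIndependent (pathGraph 1) Q1
Q1-ind _ _ here here ()

Q4-good : ∀ (j : Fin 4) → ∃ λ j′ → Adj (pathGraph 4) j j′ × lookup Q4 j′ ≡ false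
Q4-good zero = suc zero , refl , refl
Q4-good (suc zero) = suc (suc zero) , refl , refl
Q4-good (suc (suc zero)) = suc zero , refl , refl
Q4-good (suc (suc (suc zero))) = suc (suc zero) , refl , refl

P4-goodMIS : HasGoodMIS (pathGraph 4)
P4-goodMIS = Q4 , (Q4-ind , P4-independent≤2) , Q4-good , (zero , refl)

-- For O₁, O₂, O₃ the attaching vertex v
-- lies in a γ_{t,coi}-set, i.e. outside some good set S, so the new pendant
-- vertex may join S (O₁, O₃) or be dominated by v (O₁, O₂).  For O₄ the
-- support u₁ is attached and lies outside {h₁, h₂}, so any good set works.
family⇒goodMIS : ∀ {n} {T : Graph n} → InFamily T → HasGoodMIS T
family⇒goodMIS base = P4-goodMIS
family⇒goodMIS (iso f I) = goodMIS-iso I (family⇒goodMIS f)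
family⇒goodMIS (O1 {G = G} f v iv) with inSomeγ⇒outside G v (family⇒goodMIS f) iv
... | S , gm , o = S ++ᵛ Q1 , Attach.attach-goodMIS G (pathGraph 1) v zero S Q1 gm Q1-ind (λ Q′ _ → ∣p∣≤n Q′) (λ _ → o)
      (λ { zero → inj₂ (refl , o) })
family⇒goodMIS (O2 {G = G} f v iv) with inSomeγ⇒outside G v (family⇒goodMIS f) iv
... | S , gm , o = S ++ᵛ Q2 , Attach.attach-goodMIS G (pathGraph 2) v zero S Q2 gm Q2-ind P2-independent≤1 (λ ())
      (λ { zero → inj₂ (refl , o) ; (suc zero) → inj₁ (zero , refl , refl) })
family⇒goodMIS (O3 {G = G} f v iv) with inSomeγ⇒outside G v (family⇒goodMIS f) iv
... | S , gm , o = S ++ᵛ Q4 , Attach.attach-goodMIS G (pathGraph 4) v zero S Q4 gm Q4-ind P4-independent≤2 (λ _ → o)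
      (λ j → inj₁ (Q4-good j))
family⇒goodMIS (O4 {G = G} f v iv) with family⇒goodMIS f
... | S , gm = S ++ᵛ Q4 , Attach.attach-goodMIS G (pathGraph 4) v (suc zero) S Q4 gm Q4-ind P4-independent≤2 (λ ())
      (λ j → inj₁ (Q4-good j))

all-or-witness : ∀ {n} {Q W : Fin n → Set} → (∀ y → Q y ⊎ W y) → (∀ y → Q y) ⊎ (∃ W)
all-or-witness {zero} f = inj₁ (λ ())
all-or-witness {suc n} {Q} {W} f with f zero
... | inj₂ w = inj₂ (zero , w)
... | inj₁ q with all-or-witness {n} {λ y → Q (suc y)} {λ y → W (suc y)} (λ y → f (suc y))
... | inj₂ (y , w) = inj₂ (suc y , w)
... | inj₁ qs = inj₁ (λ { zero → q ; (suc y) → qs y })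

dec-guard : ∀ {A B C : Set} → Dec A → (A → B ⊎ C) → (A → B) ⊎ (A × C)
dec-guard (no na) f = inj₁ (λ a → ⊥-elim (na a))
dec-guard (yes a) f with f a
... | inj₁ b = inj₁ (λ _ → b)
... | inj₂ c = inj₂ (a , c)

-- Trails (walks that never immediately turn back) in a simple acyclic graph.
-- They are paths, hence have at most N vertices, so repeatedly lengthening a
-- trail at one of its first vertices must stop at a locally maximal trail.
module Trails {N} (T : Graph N) (simp : IsSimple T) (acyc : ¬ HasCycle T) where

  sy : ∀ a b → Adj T a b → Adj T b a
  sy = proj₁ simp
  irr : ∀ a → ¬ Adj T a a
  irr = proj₂ simp

  adj? : ∀ x y → Dec (Adj T x y)
  adj? x y = edge T x y ≟b true

  Trail : List (Fin N) → Set
  Trail [] = ⊤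
  Trail (x ∷ []) = ⊤
  Trail (x ∷ y ∷ []) = Adj T x y
  Trail (x ∷ y ∷ z ∷ l) = Adj T x y × x ≢ z × Trail (y ∷ z ∷ l)

  trail-tail : ∀ {x} l → Trail (x ∷ l) → Trail l
  trail-tail [] p = tt
  trail-tail (y ∷ []) p = tt
  trail-tail (y ∷ z ∷ l) (_ , _ , p) = p

  -- Bookkeeping on lists, to turn a repeated vertex into a cycle.
  split : ∀ {x} l → Any (x ≡_) l → ∃₂ λ (as bs : List (Fin N)) → l ≡ as ++ x ∷ bs
  split (y ∷ l) (here refl) = [] , l , refl
  split (y ∷ l) (there p) = let (as , bs , e) = split l p in y ∷ as , bs , cong (y ∷_) e

  uniqPrefix : ∀ {x : Fin N} (as : List (Fin N)) {bs : List (Fin N)} → Unique (as ++ x ∷ bs) → Unique (x ∷ as)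
  uniqPrefix [] u = [] ∷ []
  uniqPrefix {x} (a ∷ as) (allA ∷ u) with uniqPrefix as u
  ... | allX ∷ uas = ((λ e → lookupAll allA e) ∷ allX) ∷ (AllP.++⁻ˡ as allA ∷ uas)
    where
    lookupAll : ∀ {cs} → All (a ≢_) (as ++ x ∷ cs) → x ≡ a → ⊥
    lookupAll al e with AllP.++⁻ʳ as al
    ... | a≢x ∷ _ = a≢x (sym e)

  trail-linked : ∀ (l : List (Fin N)) {y : Fin N} {r : List (Fin N)} → Trail (l ++ y ∷ r) → Linked (Adj T) (l ++ [ y ])
  trail-linked [] p = [-]
  trail-linked (a ∷ []) {r = []} p = p ∷ [-]
  trail-linked (a ∷ []) {r = z ∷ r} (p , _ , _) = p ∷ [-]
  trail-linked (a ∷ b ∷ []) (p , _ , q) = p ∷ trail-linked (b ∷ []) q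
  trail-linked (a ∷ b ∷ c ∷ l) (p , _ , q) = p ∷ trail-linked (b ∷ c ∷ l) q

  -- A repeated vertex on a trail would close a cycle, so trails are paths.
  trail-unique : ∀ l → Trail l → Unique l
  trail-unique [] _ = []
  trail-unique (x ∷ l) p = AllP.¬Any⇒All¬ l noocc ∷ u
    where
    u : Unique l
    u = trail-unique l (trail-tail l p)
    noocc : ¬ Any (x ≡_) l
    noocc occ with split l occ
    ... | as , bs , refl = acyc (x , as , len as p , uniqPrefix as u , trail-linked (x ∷ as) p)
      where
      len : ∀ as → Trail (x ∷ as ++ x ∷ bs) → 2 ≤ length as
      len [] q = ⊥-elim (irr x (nbAdj bs q))
        where
        nbAdj : ∀ bs → Trail (x ∷ x ∷ bs) → Adj T x x
        nbAdj [] q = q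
        nbAdj (_ ∷ _) q = proj₁ q
      len (a ∷ []) (_ , ne , _) = ⊥-elim (ne refl)
      len (a ∷ b ∷ as) q = s≤s (s≤s z≤n)

  toSub : List (Fin N) → Subset N
  toSub [] = replicate N false
  toSub (x ∷ l) = toSub l [ x ]≔ true

  toSub-mem : ∀ l y → lookup (toSub l) y ≡ true → Any (y ≡_) l
  toSub-mem [] y e = ⊥-elim (f y e)
    where
    f : ∀ {m} (y : Fin m) → lookup (replicate m false) y ≡ true → ⊥
    f zero ()
    f (suc y) e = f y e
  toSub-mem (x ∷ l) y e with y ≟ x
  ... | yes p = here p
  ... | no ne = there (toSub-mem l y (trans (sym (lookup-upd-other (toSub l) x y true ne)) e))

  card-toSub : ∀ l → Unique l → ∣ toSub l ∣ ≡ length l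
  card-toSub [] _ = c0 N
    where
    c0 : ∀ m → ∣ replicate m false ∣ ≡ 0
    c0 zero = refl
    c0 (suc m) = c0 m
  card-toSub (x ∷ l) (ax ∷ u) with lookup (toSub l) x in e
  ... | true = ⊥-elim (AllP.All¬⇒¬Any ax (toSub-mem l x e))
  ... | false = trans (card-upd-in (toSub l) x e) (cong suc (card-toSub l u))

  len≤N : ∀ l → Trail l → length l ≤ N
  len≤N l p = subst (_≤ N) (card-toSub l (trail-unique l p)) (∣p∣≤n (toSub l))

  -- Shallow k x p: every trail starting x, y, … with y ≠ p stops before k
  -- steps; Deep k x p: some such trail of exactly k steps exists.  Shallow 1
  -- x p says that x is a leaf hanging at p.
  Shallow : ℕ → Fin N → Fin N → Set
  Shallow zero x p = ⊥
  Shallow (suc k) x p = ∀ y → Adj T x y → y ≢ p → Shallow k y x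

  Deep : ℕ → Fin N → Fin N → Set
  Deep zero x p = ⊤
  Deep (suc k) x p = ∃ λ y → Adj T x y × y ≢ p × Deep k y x

  shallow-or-deep : ∀ k x p → Shallow k x p ⊎ Deep k x p
  shallow-or-deep zero x p = inj₂ tt
  shallow-or-deep (suc k) x p =
    all-or-witness (λ y → dec-guard (adj? x y) (λ _ → dec-guard (¬? (y ≟ p)) (λ _ → shallow-or-deep k y x)))

  extend-trail : ∀ k x p rest → Deep k x p → Trail (x ∷ p ∷ rest) → ∃ λ l → Trail l × k + length (x ∷ p ∷ rest) ≡ length l
  extend-trail zero x p rest _ nb = x ∷ p ∷ rest , nb , refl
  extend-trail (suc k) x p rest (y , a , ne , w) nb with extend-trail k y x (p ∷ rest) w (sy x y a , ne , nb)
  ... | l , nbl , e = l , nbl , trans (sym (+-suc k _)) e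

  -- The front of a trail x₀x₁x₂x₃x₄… admits no extension: x₀ is a leaf at x₁,
  -- branches at x₁ other than x₂ have depth < 2, at x₂ depth < 3, at x₃ depth
  -- < 4 (for trails of at most 4 vertices, also the far end is a leaf).
  LocallyMaximal : List (Fin N) → Set
  LocallyMaximal (x0 ∷ x1 ∷ []) = Shallow 1 x0 x1 × Shallow 1 x1 x0
  LocallyMaximal (x0 ∷ x1 ∷ x2 ∷ []) = Shallow 1 x0 x1 × Shallow 2 x1 x2 × Shallow 1 x2 x1
  LocallyMaximal (x0 ∷ x1 ∷ x2 ∷ x3 ∷ []) = Shallow 1 x0 x1 × Shallow 2 x1 x2 × Shallow 3 x2 x3 × Shallow 1 x3 x2
  LocallyMaximal (x0 ∷ x1 ∷ x2 ∷ x3 ∷ x4 ∷ r) = Shallow 1 x0 x1 × Shallow 2 x1 x2 × Shallow 3 x2 x3 × Shallow 4 x3 x4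
  LocallyMaximal _ = ⊥

  Longer : List (Fin N) → Set
  Longer P = ∃ λ l → Trail l × length P < length l

  longer-from : ∀ k x p rest (P : List (Fin N)) → length P < k + length (x ∷ p ∷ rest) → Deep k x p → Trail (x ∷ p ∷ rest) → Longer P
  longer-from k x p rest P lt w nb with extend-trail k x p rest w nb
  ... | l , nbl , e = l , nbl , subst (length P <_) e lt

  maximal-or-longer : ∀ P → Trail P → 2 ≤ length P → LocallyMaximal P ⊎ Longer P
  maximal-or-longer (x0 ∷ x1 ∷ []) nb _ with shallow-or-deep 1 x0 x1 | shallow-or-deep 1 x1 x0
  ... | inj₂ w | _ = inj₂ (longer-from 1 x0 x1 [] (x0 ∷ x1 ∷ []) ≤-refl w nb)
  ... | inj₁ d0 | inj₂ (z , a , ne , _) = inj₂ (x0 ∷ x1 ∷ z ∷ [] , (nb , (λ e → ne (sym e)) , a) , ≤-refl)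
  ... | inj₁ d0 | inj₁ d1 = inj₁ (d0 , d1)
  maximal-or-longer (x0 ∷ x1 ∷ x2 ∷ []) nb _ with shallow-or-deep 1 x0 x1 | shallow-or-deep 2 x1 x2 | shallow-or-deep 1 x2 x1
  ... | inj₂ w | _ | _ = inj₂ (longer-from 1 x0 x1 (x2 ∷ []) (x0 ∷ x1 ∷ x2 ∷ []) ≤-refl w nb)
  ... | inj₁ _ | inj₂ w | _ = inj₂ (longer-from 2 x1 x2 [] (x0 ∷ x1 ∷ x2 ∷ []) ≤-refl w (proj₂ (proj₂ nb)))
  ... | inj₁ _ | inj₁ _ | inj₂ (z , a , ne , _) =
        inj₂ (x0 ∷ x1 ∷ x2 ∷ z ∷ [] , (proj₁ nb , proj₁ (proj₂ nb) , proj₂ (proj₂ nb) , (λ e → ne (sym e)) , a) , ≤-refl)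
  ... | inj₁ d0 | inj₁ d1 | inj₁ d2 = inj₁ (d0 , d1 , d2)
  maximal-or-longer (x0 ∷ x1 ∷ x2 ∷ x3 ∷ []) nb _ with shallow-or-deep 1 x0 x1 | shallow-or-deep 2 x1 x2 | shallow-or-deep 3 x2 x3 | shallow-or-deep 1 x3 x2
  ... | inj₂ w | _ | _ | _ = inj₂ (longer-from 1 x0 x1 (x2 ∷ x3 ∷ []) (x0 ∷ x1 ∷ x2 ∷ x3 ∷ []) ≤-refl w nb)
  ... | inj₁ _ | inj₂ w | _ | _ = inj₂ (longer-from 2 x1 x2 (x3 ∷ []) (x0 ∷ x1 ∷ x2 ∷ x3 ∷ []) ≤-refl w (proj₂ (proj₂ nb)))
  ... | inj₁ _ | inj₁ _ | inj₂ w | _ = inj₂ (longer-from 3 x2 x3 [] (x0 ∷ x1 ∷ x2 ∷ x3 ∷ []) ≤-refl w (proj₂ (proj₂ (proj₂ (proj₂ nb)))))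
  ... | inj₁ _ | inj₁ _ | inj₁ _ | inj₂ (z , a , ne , _) =
        inj₂ (x0 ∷ x1 ∷ x2 ∷ x3 ∷ z ∷ [] , (proj₁ nb , proj₁ (proj₂ nb) , proj₁ (proj₂ (proj₂ nb)) , proj₁ (proj₂ (proj₂ (proj₂ nb))) ,
               proj₂ (proj₂ (proj₂ (proj₂ nb))) , (λ e → ne (sym e)) , a) , ≤-refl)
  ... | inj₁ d0 | inj₁ d1 | inj₁ d2 | inj₁ d3 = inj₁ (d0 , d1 , d2 , d3)
  maximal-or-longer (x0 ∷ x1 ∷ x2 ∷ x3 ∷ x4 ∷ r) nb _ with shallow-or-deep 1 x0 x1 | shallow-or-deep 2 x1 x2 | shallow-or-deep 3 x2 x3 | shallow-or-deep 4 x3 x4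
  ... | inj₂ w | _ | _ | _ = inj₂ (longer-from 1 x0 x1 (x2 ∷ x3 ∷ x4 ∷ r) (x0 ∷ x1 ∷ x2 ∷ x3 ∷ x4 ∷ r) ≤-refl w nb)
  ... | inj₁ _ | inj₂ w | _ | _ = inj₂ (longer-from 2 x1 x2 (x3 ∷ x4 ∷ r) (x0 ∷ x1 ∷ x2 ∷ x3 ∷ x4 ∷ r) ≤-refl w (proj₂ (proj₂ nb)))
  ... | inj₁ _ | inj₁ _ | inj₂ w | _ = inj₂ (longer-from 3 x2 x3 (x4 ∷ r) (x0 ∷ x1 ∷ x2 ∷ x3 ∷ x4 ∷ r) ≤-refl w (proj₂ (proj₂ (proj₂ (proj₂ nb)))))
  ... | inj₁ _ | inj₁ _ | inj₁ _ | inj₂ w = inj₂ (longer-from 4 x3 x4 r (x0 ∷ x1 ∷ x2 ∷ x3 ∷ x4 ∷ r) ≤-refl w (proj₂ (proj₂ (proj₂ (proj₂ (proj₂ (proj₂ nb)))))))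
  ... | inj₁ d0 | inj₁ d1 | inj₁ d2 | inj₁ d3 = inj₁ (d0 , d1 , d2 , d3)
  maximal-or-longer [] nb ()
  maximal-or-longer (x ∷ []) nb (s≤s ())

  -- Iterate; the bound N on lengths ensures termination.
  reach-locally-maximal : ∀ fuel P → Trail P → 2 ≤ length P → N < length P + fuel → ∃ λ P′ → Trail P′ × LocallyMaximal P′
  reach-locally-maximal zero P nb l2 lt = ⊥-elim (<-irrefl refl (≤-trans lt (subst (_≤ N) (sym (+-identityʳ (length P))) (len≤N P nb))))
  reach-locally-maximal (suc f) P nb l2 lt with maximal-or-longer P nb l2
  ... | inj₁ g = P , nb , g
  ... | inj₂ (l , nbl , lt2) = reach-locally-maximal f l nbl (≤-trans l2 (<⇒≤ lt2))
          (≤-trans lt (subst (_≤ length l + f) (sym (+-suc (length P) f)) (+-monoˡ-≤ f lt2)))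

  locally-maximal-trail : ∀ x y → Adj T x y → ∃ λ P → Trail P × LocallyMaximal P
  locally-maximal-trail x y a = reach-locally-maximal (suc N) (x ∷ y ∷ []) a (s≤s (s≤s z≤n)) (s≤s (m≤n⇒m≤1+n (m≤n⇒m≤1+n ≤-refl)))

injection⇒surjection : ∀ {m m′} (f : Fin m → Fin m′) → m′ ≤ m → (∀ x y → f x ≡ f y → x ≡ y) → ∀ y → ∃ λ x → f x ≡ y
injection⇒surjection f le inj y with any? (λ x → f x ≟ y)
... | yes p = p
injection⇒surjection {m} {suc m₀} f (s≤s le) inj y | no np with pigeonhole {m₀} {m} (s≤s le) g
  where
  g : Fin m → Fin m₀
  g x = punchOut {i = y} {j = f x} (λ e → np (x , sym e))
... | i , j , i<j , e = ⊥-elim (FP.<-irrefl (inj i j (punchOut-injective {i = y} (λ e′ → np (i , sym e′)) (λ e′ → np (j , sym e′)) e)) i<j)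

complement-embedding : ∀ {N} k (ps : Fin k → Fin N) → (∀ a b → ps a ≡ ps b → a ≡ b) →
  Σ ℕ λ n → (n + k ≡ N) × Σ (Fin n → Fin N) λ ι → (∀ a b → ι a ≡ ι b → a ≡ b) × (∀ a j → ι a ≢ ps j)
complement-embedding {N} zero ps inj = N , +-identityʳ N , (λ a → a) , (λ a b e → e) , (λ a ())
complement-embedding {zero} (suc k) ps inj with ps zero
... | ()
complement-embedding {suc N} (suc k) ps inj with complement-embedding k ps' inj'
  where
  ne : ∀ j → ps zero ≢ ps (suc j)
  ne j e with inj _ _ e
  ... | ()
  ps' : Fin k → Fin N
  ps' j = punchOut (ne j)
  inj' : ∀ a b → ps' a ≡ ps' b → a ≡ b
  inj' a b e = suc-injective (inj _ _ (punchOut-injective (ne a) (ne b) e))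
... | n , eq , ι′ , iinj , avoid =
  n , trans (+-suc n k) (cong suc eq) , (λ a → punchIn (ps zero) (ι′ a)) ,
  (λ a b e → iinj a b (punchIn-injective (ps zero) _ _ e)) , av
  where
  ne : ∀ j → ps zero ≢ ps (suc j)
  ne j e with inj _ _ e
  ... | ()
  av : ∀ a j → punchIn (ps zero) (ι′ a) ≢ ps j
  av a zero e = punchInᵢ≢i (ps zero) (ι′ a) e
  av a (suc j) e = avoid a j (punchIn-injective (ps zero) _ _ (trans e (sym (punchIn-punchOut (ne j)))))

bool-ext : ∀ {x y : Bool} → (x ≡ true → y ≡ true) → (y ≡ true → x ≡ true) → x ≡ y
bool-ext {false} {false} f g = refl
bool-ext {false} {true} f g = g refl
bool-ext {true} {false} f g = sym (f refl)
bool-ext {true} {true} f g = refl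

record PendantDecomposition {N} (T : Graph N) (k : ℕ) (ps : Fin k → Fin N) (h : Fin k) (V : Fin N) : Set where
  field
    n : ℕ
    G : Graph n
    v : Fin n
    σ : Fin (n + k) → Fin N
    σ⁻¹ : Fin N → Fin (n + k)
    σσ⁻¹ : ∀ y → σ (σ⁻¹ y) ≡ y
    σ⁻¹σ : ∀ x → σ⁻¹ (σ x) ≡ x
    pres : ∀ x y → edge (attach G (pathGraph k) v h) x y ≡ edge T (σ x) (σ y)
    σR : ∀ j → σ (n ↑ʳ j) ≡ ps j
    σv : σ (v ↑ˡ k) ≡ V
    eqN : n + k ≡ N

-- Such a decomposition exists whenever ps spans a path P_k in T whose only
-- edge leaving it is ps h — V.  G is T restricted to the complement of ps,
-- enumerated by ι; σ sends the two blocks of attach G P_k v h to ι and ps.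
module Decompose {N} (T : Graph N) (simple : IsSimple T) (k : ℕ) (ps : Fin k → Fin N)
  (psInj : ∀ a b → ps a ≡ ps b → a ≡ b) (h : Fin k) (V : Fin N) (Vout : ∀ j → V ≢ ps j)
  (d1 : ∀ j j′ → Adj (pathGraph k) j j′ → Adj T (ps j) (ps j′))
  (d2 : ∀ j u → Adj T (ps j) u → (∃ λ j′ → u ≡ ps j′ × Adj (pathGraph k) j j′) ⊎ (j ≡ h × u ≡ V))
  (d3 : Adj T (ps h) V) where

  sy : ∀ a b → Adj T a b → Adj T b a
  sy = proj₁ simple

  rest : Σ ℕ λ n → (n + k ≡ N) × Σ (Fin n → Fin N) λ ι → (∀ a b → ι a ≡ ι b → a ≡ b) × (∀ a j → ι a ≢ ps j)
  rest = complement-embedding k ps psInj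
  n : ℕ
  n = proj₁ rest
  eq : n + k ≡ N
  eq = proj₁ (proj₂ rest)
  ι : Fin n → Fin N
  ι = proj₁ (proj₂ (proj₂ rest))
  ιinj : ∀ a b → ι a ≡ ι b → a ≡ b
  ιinj = proj₁ (proj₂ (proj₂ (proj₂ rest)))
  avoid : ∀ a j → ι a ≢ ps j
  avoid = proj₂ (proj₂ (proj₂ (proj₂ rest)))

  G : Graph n
  G = record { edge = λ a b → edge T (ι a) (ι b) }
  open Blocks n k
  σ : Fin (n + k) → Fin N
  σ x = [ ι , ps ]′ (splitAt n x)
  σL : ∀ a → σ (L a) ≡ ι a
  σL a rewrite splitAt-↑ˡ n a k = refl
  σR : ∀ j → σ (R j) ≡ ps j
  σR j rewrite splitAt-↑ʳ n k j = refl
  σinj : ∀ x y → σ x ≡ σ y → x ≡ y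
  σinj x y e with view x | view y
  ... | isL a | isL b = cong L (ιinj a b (trans (sym (σL a)) (trans e (σL b))))
  ... | isR a | isR b = cong R (psInj a b (trans (sym (σR a)) (trans e (σR b))))
  ... | isL a | isR b = ⊥-elim (avoid a b (trans (sym (σL a)) (trans e (σR b))))
  ... | isR a | isL b = ⊥-elim (avoid b a (sym (trans (sym (σR a)) (trans e (σL b)))))
  σ⁻¹ : Fin N → Fin (n + k)
  σ⁻¹ y = proj₁ (injection⇒surjection σ (≤-reflexive (sym eq)) σinj y)
  σσ⁻¹ : ∀ y → σ (σ⁻¹ y) ≡ y
  σσ⁻¹ y = proj₂ (injection⇒surjection σ (≤-reflexive (sym eq)) σinj y)
  σ⁻¹σ : ∀ x → σ⁻¹ (σ x) ≡ x
  σ⁻¹σ x = σinj _ _ (σσ⁻¹ (σ x))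
  vpair : ∀ x → View x → σ x ≡ V → Σ (Fin n) λ a → ι a ≡ V
  vpair _ (isL a) e = a , trans (sym (σL a)) e
  vpair _ (isR j) e = ⊥-elim (Vout j (trans (sym e) (σR j)))
  vp : Σ (Fin n) λ a → ι a ≡ V
  vp = vpair (σ⁻¹ V) (view (σ⁻¹ V)) (σσ⁻¹ V)
  v : Fin n
  v = proj₁ vp
  ιv : ι v ≡ V
  ιv = proj₂ vp
  σv : σ (L v) ≡ V
  σv = trans (σL v) ιv
  open Attach G (pathGraph k) v h using (eLL; eRR; eLR; eRL)
  -- σ preserves edges: within the path by d1/d2, within G by definition, and
  -- between the parts only along ps h — V (d2 again).
  ppath : ∀ a b → edge (pathGraph k) a b ≡ edge T (ps a) (ps b)
  ppath a b = bool-ext (d1 a b) back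
    where
    back : Adj T (ps a) (ps b) → Adj (pathGraph k) a b
    back e with d2 a (ps b) e
    ... | inj₁ (j′ , e′ , adj) with psInj _ _ e′
    ... | refl = adj
    back e | inj₂ (_ , e′) = ⊥-elim (Vout b (sym e′))
  plr : ∀ a b → eqb a v ∧ eqb b h ≡ edge T (ι a) (ps b)
  plr a b = bool-ext fw back
    where
    fw : eqb a v ∧ eqb b h ≡ true → Adj T (ι a) (ps b)
    fw e with eqb-sound a v (∧-l e) | eqb-sound b h (∧-r e)
    ... | refl | refl = subst (λ t → Adj T t (ps h)) (sym ιv) (sy _ _ d3)
    back : Adj T (ι a) (ps b) → eqb a v ∧ eqb b h ≡ true
    back e with d2 b (ι a) (sy _ _ e)
    ... | inj₁ (j′ , e′ , _) = ⊥-elim (avoid a j′ e′)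
    ... | inj₂ (refl , e′) with ιinj a v (trans e′ (sym ιv))
    ... | refl = cong₂ _∧_ (eqb-refl v) (eqb-refl h)
  prl : ∀ a b → eqb b v ∧ eqb a h ≡ edge T (ps a) (ι b)
  prl a b = trans (plr b a) (bool-ext (sy (ι b) (ps a)) (sy (ps a) (ι b)))
  pres : ∀ x y → edge (attach G (pathGraph k) v h) x y ≡ edge T (σ x) (σ y)
  pres x y with view x | view y
  ... | isL a | isL b rewrite σL a | σL b = eLL a b
  ... | isR a | isR b rewrite σR a | σR b = trans (eRR a b) (ppath a b)
  ... | isL a | isR b rewrite σL a | σR b = trans (eLR a b) (plr a b)
  ... | isR a | isL b rewrite σR a | σL b = trans (eRL a b) (prl a b)

  decomposition : PendantDecomposition T k ps h V
  decomposition = record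
    { n = n ; G = G ; v = v ; σ = σ ; σ⁻¹ = σ⁻¹ ; σσ⁻¹ = σσ⁻¹ ; σ⁻¹σ = σ⁻¹σ
    ; pres = pres ; σR = σR ; σv = σv ; eqN = eq }

module DecompositionIso {N} {T : Graph N} {k ps h V} (r : PendantDecomposition T k ps h V) where
  open PendantDecomposition r
  A : Graph (n + k)
  A = attach G (pathGraph k) v h
  isoAT : Iso A T
  isoAT = record { bij = mk↔ₛ′ σ σ⁻¹ σσ⁻¹ σ⁻¹σ ; preserves = pres }
  isoTA : Iso T A
  isoTA = record { bij = mk↔ₛ′ σ⁻¹ σ σ⁻¹σ σσ⁻¹
                 ; preserves = λ u w → trans (cong₂ (edge T) (sym (σσ⁻¹ u)) (sym (σσ⁻¹ w))) (sym (pres (σ⁻¹ u) (σ⁻¹ w))) }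

FamilyIfGood : ℕ → Set
FamilyIfGood N = (T : Graph N) → IsTree T → HasGoodMIS T → InFamily T

InductionHypothesis : ℕ → Set
InductionHypothesis N = ∀ {n} → n < N → FamilyIfGood n

-- Given a tree T of order N with good set S and a pendant path P_k (k ≥ 1)
-- attached at V, the remainder G is a smaller tree; when the trace of S on G
-- is good, G lies in 𝒯 by induction, and an operation attaching P_k at v
-- returns to T.  The operation's side condition on v is read off from S.
module PendantSplit {N} (T : Graph N) (tr : IsTree T) (S : Subset N) (gm : GoodMIS T S) (IH : InductionHypothesis N)
  {k} {ps : Fin k → Fin N} {h : Fin k} {V : Fin N} (r : PendantDecomposition T k ps h V) (k≥1 : 1 ≤ k) where
  open PendantDecomposition r public
  open DecompositionIso r using (isoAT; isoTA)
  module AT = Attach G (pathGraph k) v h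
  open AT using (L; R; View; view; isL; isR; LR-v; eLL; SL; SL-lk)

  treeA : IsTree (attach G (pathGraph k) v h)
  treeA = tree-iso isoTA tr
  SA : Subset (n + k)
  SA = IsoTransport.push isoTA S
  gmA : GoodMIS (attach G (pathGraph k) v h) SA
  gmA = IsoTransport.goodMIS-transport isoTA S gm
  lkSA : ∀ x → lookup SA x ≡ lookup S (σ x)
  lkSA x = IsoTransport.push-lookup isoTA S x

  treeG : IsTree G
  treeG = AT.tree-restrict treeA

  n<N : n < N
  n<N = subst (n <_) eqN (m<m+n n k≥1)

  edgeG : ∀ a b → edge G a b ≡ edge T (σ (L a)) (σ (L b))
  edgeG a b = trans (sym (eLL a b)) (pres (L a) (L b))
  adjG : ∀ a b → Adj T (σ (L a)) (σ (L b)) → Adj G a b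
  adjG a b e = trans (edgeG a b) e
  adjT : ∀ a b → Adj G a b → Adj T (σ (L a)) (σ (L b))
  adjT a b e = trans (sym (edgeG a b)) e

  pendEdge : ∀ j → Adj T V (ps j) → j ≡ h
  pendEdge j e = proj₂ (LR-v v j (trans (pres (L v) (R j)) (subst₂ (Adj T) (sym σv) (sym (σR j)) e)))

  nonPend : ∀ u → Adj T V u → u ≢ ps h → ∀ j → u ≢ ps j
  nonPend u e ne j refl with pendEdge j e
  ... | refl = ne refl

  σ-inj : ∀ x y → σ x ≡ σ y → x ≡ y
  σ-inj x y e = trans (sym (σ⁻¹σ x)) (trans (cong σ⁻¹ e) (σ⁻¹σ y))

  toL : ∀ w → (∀ j → w ≢ ps j) → Σ (Fin n) λ a → σ (L a) ≡ w
  toL w np = helper (σ⁻¹ w) (view (σ⁻¹ w)) (σσ⁻¹ w)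
    where
    helper : ∀ x → View x → σ x ≡ w → Σ (Fin n) λ a → σ (L a) ≡ w
    helper _ (isL a) e = a , e
    helper _ (isR j) e = ⊥-elim (np j (trans (sym e) (σR j)))

  SG : Subset n
  SG = SL SA

  vG : lookup SG v ≡ lookup S V
  vG = trans (SL-lk SA v) (trans (lkSA (L v)) (cong (lookup S) σv))

  remainder-goodMIS : (Q′ : Subset k) → IsIndependent (pathGraph k) Q′ →
    (∀ Q″ → IsIndependent (pathGraph k) Q″ → ∣ Q″ ∣ ≤ ∣ Q′ ∣) →
    (∀ I → IsIndependent G I → ∃ λ I′ → IsIndependent G I′ × ∣ I ∣ ≤ ∣ I′ ∣ × (In Q′ h → lookup I′ v ≡ false)) →
    (lookup S V ≡ false → ∃ λ u → Adj T V u × lookup S u ≡ false × u ≢ ps h) →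
    (lookup S V ≡ true → ∃ λ u → Adj T V u × u ≢ ps h) →
    GoodMIS G SG
  remainder-goodMIS Q′ iQ mQ swap r3T r4T = AT.restrict-goodMIS SA (proj₁ treeA) gmA Q′ iQ mQ swap r3 r4
    where
    r3 : lookup SA (L v) ≡ false → ∃ λ u → Adj G v u × lookup SA (L u) ≡ false
    r3 e with r3T (trans (sym (trans (lkSA (L v)) (cong (lookup S) σv))) e)
    ... | w , a , o , ne with toL w (nonPend w a ne)
    ... | u , eu = u , adjG v u (subst₂ (Adj T) (sym σv) (sym eu) a) , trans (lkSA (L u)) (trans (cong (lookup S) eu) o)
    r4 : lookup SA (L v) ≡ true → ∃ λ u → Adj G v u
    r4 e with r4T (trans (sym (trans (lkSA (L v)) (cong (lookup S) σv))) e)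
    ... | w , a , ne with toL w (nonPend w a ne)
    ... | u , eu = u , adjG v u (subst₂ (Adj T) (sym σv) (sym eu) a)

  famG : GoodMIS G SG → InFamily G
  famG g = IH n<N G treeG (SG , g)

  famT : InFamily (attach G (pathGraph k) v h) → InFamily T
  famT f = iso f isoAT

  inγ : (g : GoodMIS G SG) → lookup S V ≡ false → InSomeGammaSet G v
  inγ g e = outside⇒inSomeγ G SG v g (trans vG e)

  inMax : (g : GoodMIS G SG) → lookup S V ≡ true → InSomeMaxIndependentSet G v
  inMax g e = SG , proj₁ g , fromIn (trans vG e)

distinct4 : ∀ {N} {p0 p1 p2 p3 : Fin N} → Unique (p0 ∷ p1 ∷ p2 ∷ p3 ∷ []) →
  p0 ≢ p1 × p0 ≢ p2 × p0 ≢ p3 × p1 ≢ p2 × p1 ≢ p3 × p2 ≢ p3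
distinct4 ((a ∷ b ∷ c ∷ []) ∷ (d ∷ e ∷ []) ∷ (f ∷ []) ∷ [] ∷ []) = a , b , c , d , e , f

-- If u is a leaf at v, any independent set can be replaced by one of the same
-- size avoiding v (exchange v for u).  Used when deleting a pendant vertex.
swap-for-pendant : ∀ {n} (G : Graph n) → IsSimple G → ∀ v u → Adj G v u → (∀ z → Adj G u z → z ≡ v) →
  ∀ I → IsIndependent G I → ∃ λ I′ → IsIndependent G I′ × ∣ I ∣ ≤ ∣ I′ ∣ × lookup I′ v ≡ false
swap-for-pendant G (sy , irr) v u avu lu I iI with lookup I v in ev
... | false = I , iI , ≤-refl , ev
... | true = I′ , iI′ , ≤-reflexive (trans (card-upd-out I v ev) (sym (card-upd-in I₀ u I₀u))) , I′v
  where
  u≢v : u ≢ v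
  u≢v refl = irr v avu
  Iu : lookup I u ≡ false
  Iu with lookup I u in e
  ... | true = ⊥-elim (iI v u (fromIn ev) (fromIn e) avu)
  ... | false = refl
  I₀ = I [ v ]≔ false
  I₀u : lookup I₀ u ≡ false
  I₀u = trans (lookup-upd-other I v u false u≢v) Iu
  I′ = I₀ [ u ]≔ true
  I′v : lookup I′ v ≡ false
  I′v = trans (lookup-upd-other I₀ u v true (λ e → u≢v (sym e))) (lookup-upd-same I v false)
  mem : ∀ x → x ∈ I′ → x ≡ u ⊎ (x ≢ v × x ∈ I)
  mem x m with x ≟ u
  ... | yes e = inj₁ e
  ... | no ne with x ≟ v
  ... | yes refl = ⊥-elim (false⇒∉ I′v m)
  ... | no nv = inj₂ (nv , fromIn (trans (sym (trans (lookup-upd-other I₀ u x true ne) (lookup-upd-other I v x false nv))) (toIn m)))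
  iI′ : IsIndependent G I′
  iI′ x y mx my a with mem x mx | mem y my
  ... | inj₁ refl | inj₁ refl = irr x a
  ... | inj₁ refl | inj₂ (nv , _) = nv (lu y a)
  ... | inj₂ (nv , _) | inj₁ refl = nv (lu x (sy x u a))
  ... | inj₂ (_ , px) | inj₂ (_ , py) = iI x y px py a

Q4′ : Subset 4
Q4′ = false ∷ true ∷ false ∷ true ∷ []

Q4′-ind : IsIndependent (pathGraph 4) Q4′
Q4′-ind _ _ (there here) (there here) ()
Q4′-ind _ _ (there here) (there (there (there here))) ()
Q4′-ind _ _ (there (there (there here))) (there here) ()
Q4′-ind _ _ (there (there (there here))) (there (there (there here))) ()

module FourPath {N} (T : Graph N) (sy : ∀ a b → Adj T a b → Adj T b a) (p0 p1 p2 p3 : Fin N)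
  (a01 : Adj T p0 p1) (a12 : Adj T p1 p2) (a23 : Adj T p2 p3)
  (un : Unique (p0 ∷ p1 ∷ p2 ∷ p3 ∷ [])) where
  ps4 : Fin 4 → Fin N
  ps4 zero = p0
  ps4 (suc zero) = p1
  ps4 (suc (suc zero)) = p2
  ps4 (suc (suc (suc zero))) = p3

  n01 : p0 ≢ p1
  n01 = proj₁ (distinct4 un)
  n02 : p0 ≢ p2
  n02 = proj₁ (proj₂ (distinct4 un))
  n03 : p0 ≢ p3
  n03 = proj₁ (proj₂ (proj₂ (distinct4 un)))
  n12 : p1 ≢ p2
  n12 = proj₁ (proj₂ (proj₂ (proj₂ (distinct4 un))))
  n13 : p1 ≢ p3
  n13 = proj₁ (proj₂ (proj₂ (proj₂ (proj₂ (distinct4 un)))))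
  n23 : p2 ≢ p3
  n23 = proj₂ (proj₂ (proj₂ (proj₂ (proj₂ (distinct4 un)))))

  inj4 : ∀ a b → ps4 a ≡ ps4 b → a ≡ b
  inj4 zero zero _ = refl
  inj4 zero (suc zero) e = ⊥-elim (n01 e)
  inj4 zero (suc (suc zero)) e = ⊥-elim (n02 e)
  inj4 zero (suc (suc (suc zero))) e = ⊥-elim (n03 e)
  inj4 (suc zero) zero e = ⊥-elim (n01 (sym e))
  inj4 (suc zero) (suc zero) _ = refl
  inj4 (suc zero) (suc (suc zero)) e = ⊥-elim (n12 e)
  inj4 (suc zero) (suc (suc (suc zero))) e = ⊥-elim (n13 e)
  inj4 (suc (suc zero)) zero e = ⊥-elim (n02 (sym e))
  inj4 (suc (suc zero)) (suc zero) e = ⊥-elim (n12 (sym e))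
  inj4 (suc (suc zero)) (suc (suc zero)) _ = refl
  inj4 (suc (suc zero)) (suc (suc (suc zero))) e = ⊥-elim (n23 e)
  inj4 (suc (suc (suc zero))) zero e = ⊥-elim (n03 (sym e))
  inj4 (suc (suc (suc zero))) (suc zero) e = ⊥-elim (n13 (sym e))
  inj4 (suc (suc (suc zero))) (suc (suc zero)) e = ⊥-elim (n23 (sym e))
  inj4 (suc (suc (suc zero))) (suc (suc (suc zero))) _ = refl

  d1-4 : ∀ j j′ → Adj (pathGraph 4) j j′ → Adj T (ps4 j) (ps4 j′)
  d1-4 zero zero ()
  d1-4 zero (suc zero) _ = a01
  d1-4 zero (suc (suc zero)) ()
  d1-4 zero (suc (suc (suc zero))) ()
  d1-4 (suc zero) zero _ = sy _ _ a01
  d1-4 (suc zero) (suc zero) ()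
  d1-4 (suc zero) (suc (suc zero)) _ = a12
  d1-4 (suc zero) (suc (suc (suc zero))) ()
  d1-4 (suc (suc zero)) zero ()
  d1-4 (suc (suc zero)) (suc zero) _ = sy _ _ a12
  d1-4 (suc (suc zero)) (suc (suc zero)) ()
  d1-4 (suc (suc zero)) (suc (suc (suc zero))) _ = a23
  d1-4 (suc (suc (suc zero))) zero ()
  d1-4 (suc (suc (suc zero))) (suc zero) ()
  d1-4 (suc (suc (suc zero))) (suc (suc zero)) _ = sy _ _ a23
  d1-4 (suc (suc (suc zero))) (suc (suc (suc zero))) ()

-- Each recognises a configuration in a tree T with good set
-- S, splits off a pendant path, checks that the trace of S on the rest is
-- good, and concludes T ∈ 𝒯 by the matching operation.
module Reductions {N} (T : Graph N) (tr : IsTree T) (S : Subset N) (gm : GoodMIS T S) (IH : InductionHypothesis N) where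
  simp : IsSimple T
  simp = proj₁ tr
  sy : ∀ a b → Adj T a b → Adj T b a
  sy = proj₁ simp
  irr : ∀ a → ¬ Adj T a a
  irr = proj₂ simp
  iS : IsIndependent T S
  iS = proj₁ (proj₁ gm)
  gS : OutsideNeighbour T S
  gS = proj₁ (proj₂ gm)

  LeafOf : Fin N → Fin N → Set
  LeafOf x a = ∀ u → Adj T x u → u ≡ a
  NbrsIn₂ : Fin N → Fin N → Fin N → Set
  NbrsIn₂ x a b = ∀ u → Adj T x u → u ≡ a ⊎ u ≡ b
  NbrsIn₃ : Fin N → Fin N → Fin N → Fin N → Set
  NbrsIn₃ x a b c = ∀ u → Adj T x u → u ≡ a ⊎ (u ≡ b ⊎ u ≡ c)

  adj≢ : ∀ {a b} → Adj T a b → a ≢ b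
  adj≢ a refl = irr _ a

  neighbour-of-member : ∀ {a b} → Adj T a b → lookup S a ≡ true → lookup S b ≡ false
  neighbour-of-member {a} {b} e sa with lookup S b in sb
  ... | true = ⊥-elim (iS a b (fromIn sa) (fromIn sb) e)
  ... | false = refl

  -- Leaves lie in S and supports outside S: a leaf needs its support as its
  -- outside neighbour, and a leaf outside S would need it inside (maximality).
  leaf-in-support-out : ∀ ℓ s → Adj T ℓ s → LeafOf ℓ s → lookup S s ≡ false × lookup S ℓ ≡ true
  leaf-in-support-out ℓ s a l with lookup S s in es
  ... | true with gS ℓ
  ... | u , au , o with l u au
  ... | refl = ⊥-elim (true≢false (trans (sym es) o))
  leaf-in-support-out ℓ s a l | false with lookup S ℓ in el
  ... | true = refl , refl
  ... | false with maximum⇒maximal T S simp (proj₁ gm) ℓ el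
  ... | y , ay , yin with l y ay
  ... | refl = ⊥-elim (true≢false (trans (sym yin) es))

  -- O₁: w has two leaves y, y′.  Delete y; w ∉ S.  The remainder keeps a good
  -- set since y′ can replace w in any independent set.
  reduce-O1 : ∀ w y y′ → Adj T w y → Adj T w y′ → y ≢ y′ → LeafOf y w → LeafOf y′ w → InFamily T
  reduce-O1 w y y′ a a′ ne ly ly′ = famT (O1 (famG g) v (inγ g w∉S))
    where
    ps : Fin 1 → Fin N
    ps _ = y
    r : PendantDecomposition T 1 ps zero w
    r = Decompose.decomposition T simp 1 ps (λ { zero zero _ → refl }) zero w (λ _ → adj≢ a)
          (λ { zero zero () }) (λ { zero u e → inj₂ (refl , ly u e) }) (sy _ _ a)
    open PendantSplit T tr S gm IH r (s≤s z≤n)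
    w∉S : lookup S w ≡ false
    w∉S = proj₁ (leaf-in-support-out y w (sy _ _ a) ly)
    y∈S : lookup S y ≡ true
    y∈S = proj₂ (leaf-in-support-out y w (sy _ _ a) ly)
    y′-in-G : Σ (Fin n) λ b → σ (AT.L b) ≡ y′
    y′-in-G = toL y′ (nonPend y′ a′ (λ e → ne (sym e)))
    u′ : Fin n
    u′ = proj₁ y′-in-G
    eu′ : σ (AT.L u′) ≡ y′
    eu′ = proj₂ y′-in-G
    avu : Adj G v u′
    avu = adjG v u′ (subst₂ (Adj T) (sym σv) (sym eu′) a′)
    lu : ∀ z → Adj G u′ z → z ≡ v
    lu z e = AT.L-inj z v (σ-inj _ _ (trans (ly′ _ (subst₂ (Adj T) eu′ refl (adjT u′ z e))) (sym σv)))
    swap : ∀ I → IsIndependent G I → ∃ λ I′ → IsIndependent G I′ × ∣ I ∣ ≤ ∣ I′ ∣ × (In Q1 zero → lookup I′ v ≡ false)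
    swap I iI = let (I′ , i′ , le , o) = swap-for-pendant G (proj₁ treeG) v u′ avu lu I iI in I′ , i′ , le , (λ _ → o)
    r3T : lookup S w ≡ false → ∃ λ u → Adj T w u × lookup S u ≡ false × u ≢ y
    r3T _ = let (u , au , o) = gS w in u , au , o , (λ { refl → true≢false (trans (sym y∈S) o) })
    r4T : lookup S w ≡ true → ∃ λ u → Adj T w u × u ≢ y
    r4T _ = y′ , a′ , (λ e → ne (sym e))
    g : GoodMIS G SG
    g = remainder-goodMIS Q1 Q1-ind (λ Q″ _ → ∣p∣≤n Q″) swap r3T r4T

  -- O₂: a pendant P₂ = ℓ s hangs at p ∉ S, and p has a neighbour u ≠ s
  -- outside S.  Delete ℓ s.
  reduce-O2 : ∀ ℓ s p u → Adj T s ℓ → Adj T s p → LeafOf ℓ s → NbrsIn₂ s ℓ p → Adj T p u → u ≢ s →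
    lookup S u ≡ false → lookup S p ≡ false → InFamily T
  reduce-O2 ℓ s p u asl asp lℓ ls apu u≢s su sp = famT (O2 (famG g) v (inγ g sp))
    where
    ℓ≢p : ℓ ≢ p
    ℓ≢p refl = u≢s (lℓ u apu)
    ps : Fin 2 → Fin N
    ps zero = s
    ps (suc zero) = ℓ
    psInj : ∀ a b → ps a ≡ ps b → a ≡ b
    psInj zero zero _ = refl
    psInj zero (suc zero) e = ⊥-elim (adj≢ asl e)
    psInj (suc zero) zero e = ⊥-elim (adj≢ asl (sym e))
    psInj (suc zero) (suc zero) _ = refl
    Vout : ∀ j → p ≢ ps j
    Vout zero e = adj≢ asp (sym e)
    Vout (suc zero) e = ℓ≢p (sym e)
    d1 : ∀ j j′ → Adj (pathGraph 2) j j′ → Adj T (ps j) (ps j′)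
    d1 zero zero ()
    d1 zero (suc zero) _ = asl
    d1 (suc zero) zero _ = sy _ _ asl
    d1 (suc zero) (suc zero) ()
    d2 : ∀ j u′ → Adj T (ps j) u′ → (∃ λ j′ → u′ ≡ ps j′ × Adj (pathGraph 2) j j′) ⊎ (j ≡ zero × u′ ≡ p)
    d2 zero u′ e with ls u′ e
    ... | inj₁ e′ = inj₁ (suc zero , e′ , refl)
    ... | inj₂ e′ = inj₂ (refl , e′)
    d2 (suc zero) u′ e = inj₁ (zero , lℓ u′ e , refl)
    r : PendantDecomposition T 2 ps zero p
    r = Decompose.decomposition T simp 2 ps psInj zero p Vout d1 d2 asp
    open PendantSplit T tr S gm IH r (s≤s z≤n)
    g : GoodMIS G SG
    g = remainder-goodMIS Q2 Q2-ind P2-independent≤1 (λ I iI → I , iI , ≤-refl , (λ ())) (λ _ → u , apu , su , u≢s) (λ _ → u , apu , u≢s)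

  -- O₃: a pendant P₄ = x₃x₂x₁x₀ hangs at its leaf end x₃ ∈ S from x₄ (so
  -- x₄ ∉ S).  Delete it; {x₂, x₀} is the maximum independent set used on it.
  reduce-O3 : ∀ x0 x1 x2 x3 x4 → Adj T x0 x1 → Adj T x1 x2 → Adj T x2 x3 → Adj T x3 x4 →
    LeafOf x0 x1 → NbrsIn₂ x1 x0 x2 → NbrsIn₂ x2 x1 x3 → NbrsIn₂ x3 x2 x4 →
    Unique (x3 ∷ x2 ∷ x1 ∷ x0 ∷ []) → x4 ≢ x0 → x4 ≢ x1 → x4 ≢ x2 →
    lookup S x3 ≡ true → InFamily T
  reduce-O3 x0 x1 x2 x3 x4 a01 a12 a23 a34 l0 l1 l2 l3 un n40 n41 n42 s3 = famT (O3 (famG g) v (inγ g s4))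
    where
    open FourPath T sy x3 x2 x1 x0 (sy _ _ a23) (sy _ _ a12) (sy _ _ a01) un
    Vout : ∀ j → x4 ≢ ps4 j
    Vout zero e = adj≢ a34 (sym e)
    Vout (suc zero) = n42
    Vout (suc (suc zero)) = n41
    Vout (suc (suc (suc zero))) = n40
    d2 : ∀ j u′ → Adj T (ps4 j) u′ → (∃ λ j′ → u′ ≡ ps4 j′ × Adj (pathGraph 4) j j′) ⊎ (j ≡ zero × u′ ≡ x4)
    d2 zero u′ e with l3 u′ e
    ... | inj₁ e′ = inj₁ (suc zero , e′ , refl)
    ... | inj₂ e′ = inj₂ (refl , e′)
    d2 (suc zero) u′ e with l2 u′ e
    ... | inj₁ e′ = inj₁ (suc (suc zero) , e′ , refl)
    ... | inj₂ e′ = inj₁ (zero , e′ , refl)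
    d2 (suc (suc zero)) u′ e with l1 u′ e
    ... | inj₁ e′ = inj₁ (suc (suc (suc zero)) , e′ , refl)
    ... | inj₂ e′ = inj₁ (suc zero , e′ , refl)
    d2 (suc (suc (suc zero))) u′ e = inj₁ (suc (suc zero) , l0 u′ e , refl)
    r : PendantDecomposition T 4 ps4 zero x4
    r = Decompose.decomposition T simp 4 ps4 inj4 zero x4 Vout d1-4 d2 a34
    open PendantSplit T tr S gm IH r (s≤s z≤n)
    s4 : lookup S x4 ≡ false
    s4 = neighbour-of-member a34 s3
    r3T : lookup S x4 ≡ false → ∃ λ u → Adj T x4 u × lookup S u ≡ false × u ≢ x3
    r3T _ = let (u , au , o) = gS x4 in u , au , o , (λ { refl → true≢false (trans (sym s3) o) })
    g : GoodMIS G SG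
    g = remainder-goodMIS Q4′ Q4′-ind P4-independent≤2 (λ I iI → I , iI , ≤-refl , (λ ())) r3T (λ e → ⊥-elim (true≢false (trans (sym e) s4)))

  -- O₄: a pendant P₄ = y c s ℓ hangs at its support vertex c from V ∈ S, and
  -- V has a neighbour u ≠ c.  Delete it; V then lies in a maximum
  -- independent set of the remainder.
  reduce-O4 : ∀ y c s ℓ V u → Adj T y c → Adj T c s → Adj T s ℓ → Adj T c V →
    LeafOf y c → NbrsIn₃ c y s V → NbrsIn₂ s c ℓ → LeafOf ℓ s →
    Unique (y ∷ c ∷ s ∷ ℓ ∷ []) → V ≢ y → V ≢ s → V ≢ ℓ →
    lookup S V ≡ true → Adj T V u → u ≢ c → InFamily T
  reduce-O4 y c s ℓ V u ayc acs asl acV ly lc ls lℓ un nVy nVs nVℓ sV aVu u≢c = famT (O4 (famG g) v (inMax g sV))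
    where
    open FourPath T sy y c s ℓ ayc acs asl un
    Vout : ∀ j → V ≢ ps4 j
    Vout zero = nVy
    Vout (suc zero) e = adj≢ acV (sym e)
    Vout (suc (suc zero)) = nVs
    Vout (suc (suc (suc zero))) = nVℓ
    d2 : ∀ j u′ → Adj T (ps4 j) u′ → (∃ λ j′ → u′ ≡ ps4 j′ × Adj (pathGraph 4) j j′) ⊎ (j ≡ suc zero × u′ ≡ V)
    d2 zero u′ e = inj₁ (suc zero , ly u′ e , refl)
    d2 (suc zero) u′ e with lc u′ e
    ... | inj₁ e′ = inj₁ (zero , e′ , refl)
    ... | inj₂ (inj₁ e′) = inj₁ (suc (suc zero) , e′ , refl)
    ... | inj₂ (inj₂ e′) = inj₂ (refl , e′)
    d2 (suc (suc zero)) u′ e with ls u′ e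
    ... | inj₁ e′ = inj₁ (suc zero , e′ , refl)
    ... | inj₂ e′ = inj₁ (suc (suc (suc zero)) , e′ , refl)
    d2 (suc (suc (suc zero))) u′ e = inj₁ (suc (suc zero) , lℓ u′ e , refl)
    r : PendantDecomposition T 4 ps4 (suc zero) V
    r = Decompose.decomposition T simp 4 ps4 inj4 (suc zero) V Vout d1-4 d2 acV
    open PendantSplit T tr S gm IH r (s≤s z≤n)
    g : GoodMIS G SG
    g = remainder-goodMIS Q4 Q4-ind P4-independent≤2 (λ I iI → I , iI , ≤-refl , (λ ()))
          (λ e → ⊥-elim (true≢false (trans (sym sV) e))) (λ _ → u , aVu , u≢c)

  recognise-P4 : ∀ x0 x1 x2 x3 → Adj T x0 x1 → Adj T x1 x2 → Adj T x2 x3 →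
    LeafOf x0 x1 → NbrsIn₂ x1 x0 x2 → NbrsIn₂ x2 x1 x3 → LeafOf x3 x2 → Unique (x0 ∷ x1 ∷ x2 ∷ x3 ∷ []) → InFamily T
  recognise-P4 x0 x1 x2 x3 a01 a12 a23 l0 l1 l2 l3 un = iso base I
    where
    open FourPath T sy x0 x1 x2 x3 a01 a12 a23 un
    nb : ∀ i u → Adj T (ps4 i) u → ∃ λ j′ → u ≡ ps4 j′ × Adj (pathGraph 4) i j′
    nb zero u e = suc zero , l0 u e , refl
    nb (suc zero) u e with l1 u e
    ... | inj₁ e′ = zero , e′ , refl
    ... | inj₂ e′ = suc (suc zero) , e′ , refl
    nb (suc (suc zero)) u e with l2 u e
    ... | inj₁ e′ = suc zero , e′ , refl
    ... | inj₂ e′ = suc (suc (suc zero)) , e′ , refl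
    nb (suc (suc (suc zero))) u e = suc (suc zero) , l3 u e , refl
    cl : ∀ {x z m} → Walk T x z m → ∀ i → x ≡ ps4 i → ∃ λ j → ps4 j ≡ z
    cl nil i e = i , sym e
    cl (cons a w) i refl = let (j , e , _) = nb i _ a in cl w j e
    surj : ∀ z → ∃ λ j → ps4 j ≡ z
    surj z = cl (proj₂ (proj₁ (proj₂ tr) x0 z)) zero refl
    back : ∀ i j → Adj T (ps4 i) (ps4 j) → Adj (pathGraph 4) i j
    back i j e with nb i (ps4 j) e
    ... | j′ , e′ , p with inj4 _ _ e′
    ... | refl = p
    I : Iso (pathGraph 4) T
    I = record { bij = mk↔ₛ′ ps4 (λ z → proj₁ (surj z)) (λ z → proj₂ (surj z)) (λ i → inj4 _ _ (proj₂ (surj (ps4 i))))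
               ; preserves = λ i j → bool-ext (d1-4 i j) (back i j) }

module CaseAnalysis {N} (T : Graph N) (tr : IsTree T) (S : Subset N) (gm : GoodMIS T S) (IH : InductionHypothesis N) where
  open Reductions T tr S gm IH
  open Trails T simp (proj₂ (proj₂ tr)) hiding (sy; irr)

  dNeq : ∀ (a b : Fin N) → Dec (a ≢ b)
  dNeq a b = ¬? (a ≟ b)

  other-neighbour₁ : ∀ x a → (∃ λ y → Adj T x y × y ≢ a) ⊎ LeafOf x a
  other-neighbour₁ x a with any? (λ y → adj? x y ×-dec dNeq y a)
  ... | yes p = inj₁ p
  ... | no np = inj₂ f
    where
    f : LeafOf x a
    f u e with u ≟ a
    ... | yes q = q
    ... | no ne = ⊥-elim (np (u , e , ne))

  other-neighbour₂ : ∀ x a b → (∃ λ y → Adj T x y × y ≢ a × y ≢ b) ⊎ NbrsIn₂ x a b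
  other-neighbour₂ x a b with any? (λ y → adj? x y ×-dec dNeq y a ×-dec dNeq y b)
  ... | yes p = inj₁ p
  ... | no np = inj₂ f
    where
    f : NbrsIn₂ x a b
    f u e with u ≟ a | u ≟ b
    ... | yes q | _ = inj₁ q
    ... | no _ | yes q = inj₂ q
    ... | no na | no nb = ⊥-elim (np (u , e , na , nb))

  other-neighbour₃ : ∀ x a b c → (∃ λ y → Adj T x y × y ≢ a × y ≢ b × y ≢ c) ⊎ NbrsIn₃ x a b c
  other-neighbour₃ x a b c with any? (λ y → adj? x y ×-dec dNeq y a ×-dec dNeq y b ×-dec dNeq y c)
  ... | yes p = inj₁ p
  ... | no np = inj₂ f
    where
    f : NbrsIn₃ x a b c
    f u e with u ≟ a | u ≟ b | u ≟ c
    ... | yes q | _ | _ = inj₁ q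
    ... | no _ | yes q | _ = inj₂ (inj₁ q)
    ... | no _ | no _ | yes q = inj₂ (inj₂ q)
    ... | no na | no nb | no nc = ⊥-elim (np (u , e , na , nb , nc))

  outside-neighbour : ∀ x a → (∃ λ u → Adj T x u × u ≢ a × lookup S u ≡ false) ⊎ (∀ u → Adj T x u → u ≢ a → lookup S u ≡ true)
  outside-neighbour x a with any? (λ u → adj? x u ×-dec dNeq u a ×-dec (lookup S u ≟b false))
  ... | yes p = inj₁ p
  ... | no np = inj₂ f
    where
    f : ∀ u → Adj T x u → u ≢ a → lookup S u ≡ true
    f u e ne with lookup S u in eu
    ... | true = refl
    ... | false = ⊥-elim (np (u , e , ne , eu))

  shallow⇒leaf : ∀ {x p} → Shallow 1 x p → LeafOf x p
  shallow⇒leaf {x} {p} d u e with u ≟ p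
  ... | yes q = q
  ... | no ne = ⊥-elim (d u e ne)

  -- A vertex all of whose neighbours are leaves (a star centre) is impossible:
  -- it is a support, so outside S, yet all its neighbours are leaves in S.
  no-star : ∀ c → (∀ y → Adj T c y → LeafOf y c) → ⊥
  no-star c h with gS c
  ... | u , e , o = true≢false (trans (sym (proj₂ (leaf-in-support-out u c (sy _ _ e) (h u e)))) o)

  -- A member y ∈ S of depth < 2 away from x is a leaf: a further neighbour z
  -- would be a leaf at y, so z ∈ S next to y ∈ S.
  member-leaf : ∀ x y → Adj T x y → lookup S y ≡ true → Shallow 2 y x → LeafOf y x
  member-leaf x y a sy1 d with other-neighbour₁ y x
  ... | inj₂ l = l
  ... | inj₁ (z , ayz , nz) = ⊥-elim (true≢false (trans (sym (proj₂ (leaf-in-support-out z y (sy _ _ ayz) (shallow⇒leaf (d z ayz nz))))) (neighbour-of-member ayz sy1)))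

  -- S cannot contain z when a, b ∉ S are distinct, non-adjacent, and z is their
  -- only neighbour in S: S − z + a + b would be a larger independent set.
  exchange-contradiction : ∀ a b z → lookup S z ≡ true → lookup S a ≡ false → lookup S b ≡ false → a ≢ b → a ≢ z → b ≢ z →
    ¬ Adj T a b → (∀ y → Adj T a y → y ≡ z ⊎ lookup S y ≡ false) → (∀ y → Adj T b y → y ≡ z ⊎ lookup S y ≡ false) → ⊥
  exchange-contradiction a b z sz sa sb a≢b a≢z b≢z nab na nb = <-irrefl refl (subst (_≤ ∣ S ∣) card (proj₂ (proj₁ gm) S′ iS′))
    where
    S0 = S [ z ]≔ false
    S1 = S0 [ a ]≔ true
    S′ = S1 [ b ]≔ true
    S0a : lookup S0 a ≡ false
    S0a = trans (lookup-upd-other S z a false a≢z) sa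
    S1b : lookup S1 b ≡ false
    S1b = trans (lookup-upd-other S0 a b true (λ e → a≢b (sym e))) (trans (lookup-upd-other S z b false b≢z) sb)
    card : ∣ S′ ∣ ≡ suc ∣ S ∣
    card = trans (card-upd-in S1 b S1b) (cong suc (trans (card-upd-in S0 a S0a) (sym (card-upd-out S z sz))))
    mem : ∀ x → x ∈ S′ → x ≡ a ⊎ (x ≡ b ⊎ (x ≢ z × lookup S x ≡ true))
    mem x m with x ≟ b
    ... | yes e = inj₂ (inj₁ e)
    ... | no nb′ with x ≟ a
    ... | yes e = inj₁ e
    ... | no na′ with x ≟ z
    ... | yes refl = ⊥-elim (true≢false (trans (sym (toIn m)) (trans (lookup-upd-other S1 b x true nb′) (trans (lookup-upd-other S0 a x true na′) (lookup-upd-same S z false)))))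
    ... | no nz = inj₂ (inj₂ (nz , trans (sym (trans (lookup-upd-other S1 b x true nb′) (trans (lookup-upd-other S0 a x true na′) (lookup-upd-other S z x false nz)))) (toIn m)))
    noS : ∀ {y} → (y ≡ z ⊎ lookup S y ≡ false) → y ≢ z → lookup S y ≡ true → ⊥
    noS (inj₁ e) nz _ = nz e
    noS (inj₂ f) _ t = true≢false (trans (sym t) f)
    iS′ : IsIndependent T S′
    iS′ x y mx my e with mem x mx | mem y my
    ... | inj₁ refl | inj₁ refl = irr _ e
    ... | inj₁ refl | inj₂ (inj₁ refl) = nab e
    ... | inj₁ refl | inj₂ (inj₂ (nz , t)) = noS (na y e) nz t
    ... | inj₂ (inj₁ refl) | inj₁ refl = nab (sy _ _ e)
    ... | inj₂ (inj₁ refl) | inj₂ (inj₁ refl) = irr _ e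
    ... | inj₂ (inj₁ refl) | inj₂ (inj₂ (nz , t)) = noS (nb y e) nz t
    ... | inj₂ (inj₂ (nz , t)) | inj₁ refl = noS (na x (sy _ _ e)) nz t
    ... | inj₂ (inj₂ (nz , t)) | inj₂ (inj₁ refl) = noS (nb x (sy _ _ e)) nz t
    ... | inj₂ (inj₂ (_ , t)) | inj₂ (inj₂ (_ , t′)) = iS x y (fromIn t) (fromIn t′) e

  swap2 : ∀ {x a b} → NbrsIn₂ x a b → NbrsIn₂ x b a
  swap2 l u e with l u e
  ... | inj₁ q = inj₂ q
  ... | inj₂ q = inj₁ q

  rot3 : ∀ {x a b c} → NbrsIn₃ x a b c → NbrsIn₃ x c a b
  rot3 l u e with l u e
  ... | inj₁ q = inj₂ (inj₁ q)
  ... | inj₂ (inj₁ q) = inj₂ (inj₂ q)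
  ... | inj₂ (inj₂ q) = inj₁ q

  TailT : Fin N → Fin N → Fin N → Fin N → Set
  TailT x0 x1 x2 x3 = LeafOf x0 x1 → NbrsIn₂ x1 x0 x2 → NbrsIn₂ x2 x1 x3 → lookup S x3 ≡ true → lookup S x2 ≡ false →
    lookup S x1 ≡ false → InFamily T

  -- If x₁ has a third neighbour, it is a second leaf: O₁.
  -- Else if x₂ has a neighbour u ≠ x₁ outside S: O₂ with the pendant x₀x₁.
  -- Else all neighbours of x₂ but x₁ are in S; those other than x₃ are leaves
  -- (member-leaf).  Two of them: O₁.  One, y: if x₃ is a leaf, O₁; otherwise
  -- O₄ with the pendant y x₂ x₁ x₀ at x₃ ∈ S.  None: the tail case.
  module FromLeafEnd (x0 x1 x2 x3 : Fin N) (a01 : Adj T x0 x1) (a12 : Adj T x1 x2) (a23 : Adj T x2 x3)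
    (n01 : x0 ≢ x1) (n02 : x0 ≢ x2) (n03 : x0 ≢ x3) (n12 : x1 ≢ x2) (n13 : x1 ≢ x3) (n23 : x2 ≢ x3)
    (d0 : Shallow 1 x0 x1) (d1 : Shallow 2 x1 x2) (d2 : Shallow 3 x2 x3) (tail-case : TailT x0 x1 x2 x3) where

    l0 : LeafOf x0 x1
    l0 = shallow⇒leaf d0
    s1F : lookup S x1 ≡ false
    s1F = proj₁ (leaf-in-support-out x0 x1 a01 l0)
    s0T : lookup S x0 ≡ true
    s0T = proj₂ (leaf-in-support-out x0 x1 a01 l0)

    s2F : NbrsIn₂ x1 x0 x2 → lookup S x2 ≡ false
    s2F l1 with gS x1
    ... | w , aw , o with l1 w aw
    ... | inj₁ refl = ⊥-elim (true≢false (trans (sym s0T) o))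
    ... | inj₂ refl = o

    AllS : Set
    AllS = ∀ u → Adj T x2 u → u ≢ x1 → lookup S u ≡ true

    leafY : AllS → ∀ y → Adj T x2 y → y ≢ x1 → y ≢ x3 → LeafOf y x2
    leafY allS y a n1 n3 = member-leaf x2 y a (allS y a n1) (d2 y a n3)

    at-x2-leaf : NbrsIn₂ x1 x0 x2 → AllS → ∀ y → Adj T x2 y → y ≢ x1 → y ≢ x3 → LeafOf y x2 →
      (∃ λ y′ → Adj T x2 y′ × y′ ≢ x1 × y′ ≢ x3 × y′ ≢ y) ⊎ NbrsIn₃ x2 x1 x3 y → InFamily T
    at-x2-leaf l1 allS y ay n1 n3 ly (inj₁ (y′ , ay′ , m1 , m3 , my)) =
      reduce-O1 x2 y y′ ay ay′ (λ e → my (sym e)) ly (leafY allS y′ ay′ m1 m3)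
    at-x2-leaf l1 allS y ay n1 n3 ly (inj₂ l2) with other-neighbour₁ x3 x2
    ... | inj₂ l3 = reduce-O1 x2 y x3 ay a23 n3 ly l3
    ... | inj₁ (u , a3u , nu) =
      reduce-O4 y x2 x1 x0 x3 u (sy _ _ ay) (sy _ _ a12) (sy _ _ a01) a23 ly (rot3 l2) (swap2 l1) l0 unq′
        (λ e → n3 (sym e)) (λ e → n13 (sym e)) (λ e → n03 (sym e)) (allS x3 a23 (λ e → n13 (sym e))) a3u nu
      where
      y≢x0 : y ≢ x0
      y≢x0 refl = n12 (sym (l0 x2 (sy _ _ ay)))
      unq′ : Unique (y ∷ x2 ∷ x1 ∷ x0 ∷ [])
      unq′ = (adj≢ (sy _ _ ay) ∷ n1 ∷ y≢x0 ∷ []) ∷ ((λ e → n12 (sym e)) ∷ (λ e → n02 (sym e)) ∷ []) ∷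
             ((λ e → n01 (sym e)) ∷ []) ∷ [] ∷ []

    at-x2-branches : NbrsIn₂ x1 x0 x2 → AllS → (∃ λ y → Adj T x2 y × y ≢ x1 × y ≢ x3) ⊎ NbrsIn₂ x2 x1 x3 → InFamily T
    at-x2-branches l1 allS (inj₁ (y , ay , n1 , n3)) = at-x2-leaf l1 allS y ay n1 n3 (leafY allS y ay n1 n3) (other-neighbour₃ x2 x1 x3 y)
    at-x2-branches l1 allS (inj₂ l2) = tail-case l0 l1 l2 (allS x3 a23 (λ e → n13 (sym e))) (s2F l1) s1F

    at-x2 : NbrsIn₂ x1 x0 x2 → (∃ λ u → Adj T x2 u × u ≢ x1 × lookup S u ≡ false) ⊎ AllS → InFamily T
    at-x2 l1 (inj₁ (u , a , ne , o)) = reduce-O2 x0 x1 x2 u (sy _ _ a01) a12 l0 l1 a ne o (s2F l1)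
    at-x2 l1 (inj₂ allS) = at-x2-branches l1 allS (other-neighbour₂ x2 x1 x3)

    at-x1 : (∃ λ y → Adj T x1 y × y ≢ x0 × y ≢ x2) ⊎ NbrsIn₂ x1 x0 x2 → InFamily T
    at-x1 (inj₁ (y , a , n0 , n2)) = reduce-O1 x1 x0 y (sy _ _ a01) a (λ e → n0 (sym e)) l0 (shallow⇒leaf (d1 y a n2))
    at-x1 (inj₂ l1) = at-x2 l1 (outside-neighbour x2 x1)

    result : InFamily T
    result = at-x1 (other-neighbour₂ x1 x0 x2)

  -- The tail case on a trail with a fifth vertex x₄.  If N(x₃) = {x₂, x₄}: O₃
  -- with the pendant x₃x₂x₁x₀.  Otherwise x₃ has a branch c ∉ S of depth < 3.
  module BeyondX3 (x0 x1 x2 x3 x4 : Fin N) (a01 : Adj T x0 x1) (a12 : Adj T x1 x2) (a23 : Adj T x2 x3) (a34 : Adj T x3 x4)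
    (n01 : x0 ≢ x1) (n02 : x0 ≢ x2) (n03 : x0 ≢ x3) (n12 : x1 ≢ x2) (n13 : x1 ≢ x3) (n23 : x2 ≢ x3)
    (n04 : x0 ≢ x4) (n14 : x1 ≢ x4) (n24 : x2 ≢ x4)
    (d3 : Shallow 4 x3 x4) where

    -- At the branch c: c has a neighbour s ∉ S, not a leaf, whose further
    -- neighbours are leaves.  Two of them: O₁.  One, ℓ: if c has a neighbour
    -- u ≠ s outside S, O₂ with the pendant ℓ s; else c's neighbours other than
    -- s are in S, those besides x₃ being leaves.  Two such leaves: O₁; one, y:
    -- O₄ with the pendant y c s ℓ at x₃; none: x₂ and c contradict maximality
    -- of S via x₃ (exchange-contradiction).
    module ViaBranch (l0 : LeafOf x0 x1) (l1 : NbrsIn₂ x1 x0 x2) (l2 : NbrsIn₂ x2 x1 x3) (s3 : lookup S x3 ≡ true)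
      (s2F : lookup S x2 ≡ false) (s1F : lookup S x1 ≡ false)
      (c : Fin N) (ac : Adj T x3 c) (nc2 : c ≢ x2) (nc4 : c ≢ x4) where
      scF : lookup S c ≡ false
      scF = neighbour-of-member ac s3
      dc : Shallow 3 c x3
      dc = d3 c ac nc4
      c≢x1 : c ≢ x1
      c≢x1 refl with l1 x3 (sy _ _ ac)
      ... | inj₁ e = n03 (sym e)
      ... | inj₂ e = n23 (sym e)

      at-c-branches : ∀ s ℓ → Adj T c s → lookup S s ≡ false → s ≢ x3 → Adj T s ℓ → ℓ ≢ c → LeafOf ℓ s → NbrsIn₂ s c ℓ →
        (∀ u → Adj T c u → u ≢ s → lookup S u ≡ true) →
        (∃ λ y → Adj T c y × y ≢ s × y ≢ x3) ⊎ NbrsIn₂ c s x3 → InFamily T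
      at-c-branches s ℓ acs ss s≢x3 asl nℓ lℓ ls allSc (inj₁ (y , acy , ns , n3c)) with other-neighbour₃ c s x3 y
      ... | inj₁ (y′ , acy′ , ms , m3 , my) =
            reduce-O1 c y y′ acy acy′ (λ e → my (sym e)) ly (member-leaf c y′ acy′ (allSc y′ acy′ ms) (dc y′ acy′ m3))
        where
        ly = member-leaf c y acy (allSc y acy ns) (dc y acy n3c)
      ... | inj₂ lc =
            reduce-O4 y c s ℓ x3 x2 (sy _ _ acy) acs asl (sy _ _ ac) ly (rot3 lc) ls lℓ unC
              (λ e → n3c (sym e)) (λ e → s≢x3 (sym e)) x3≢ℓ s3 (sy _ _ a23) (λ e → nc2 (sym e))
        where
        ly = member-leaf c y acy (allSc y acy ns) (dc y acy n3c)
        y≢ℓ : y ≢ ℓ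
        y≢ℓ refl = adj≢ acs (lℓ c (sy _ _ acy))
        x3≢ℓ : x3 ≢ ℓ
        x3≢ℓ refl = adj≢ acs (lℓ c ac)
        unC : Unique (y ∷ c ∷ s ∷ ℓ ∷ [])
        unC = (adj≢ (sy _ _ acy) ∷ ns ∷ y≢ℓ ∷ []) ∷ (adj≢ acs ∷ (λ e → nℓ (sym e)) ∷ []) ∷ (adj≢ asl ∷ []) ∷ [] ∷ []
      at-c-branches s ℓ acs ss s≢x3 asl nℓ lℓ ls allSc (inj₂ lc2) =
        ⊥-elim (exchange-contradiction x2 c x3 s3 s2F scF (λ e → nc2 (sym e)) n23 (adj≢ (sy _ _ ac)) nadj na nb)
        where
        nadj : ¬ Adj T x2 c
        nadj e with l2 c e
        ... | inj₁ q = c≢x1 q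
        ... | inj₂ q = adj≢ (sy _ _ ac) q
        na : ∀ y → Adj T x2 y → y ≡ x3 ⊎ lookup S y ≡ false
        na y e with l2 y e
        ... | inj₁ refl = inj₂ s1F
        ... | inj₂ q = inj₁ q
        nb : ∀ y → Adj T c y → y ≡ x3 ⊎ lookup S y ≡ false
        nb y e with lc2 y e
        ... | inj₁ refl = inj₂ ss
        ... | inj₂ q = inj₁ q

      at-c : ∀ s ℓ → Adj T c s → lookup S s ≡ false → s ≢ x3 → Adj T s ℓ → ℓ ≢ c → LeafOf ℓ s → NbrsIn₂ s c ℓ →
        (∃ λ u → Adj T c u × u ≢ s × lookup S u ≡ false) ⊎ (∀ u → Adj T c u → u ≢ s → lookup S u ≡ true) → InFamily T
      at-c s ℓ acs ss s≢x3 asl nℓ lℓ ls (inj₁ (u , acu , ne , o)) = reduce-O2 ℓ s c u asl (sy _ _ acs) lℓ (swap2 ls) acu ne o scF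
      at-c s ℓ acs ss s≢x3 asl nℓ lℓ ls (inj₂ allSc) = at-c-branches s ℓ acs ss s≢x3 asl nℓ lℓ ls allSc (other-neighbour₂ c s x3)

      result : InFamily T
      result with gS c
      ... | s , acs , ss = go (other-neighbour₁ s c)
        where
        s≢x3 : s ≢ x3
        s≢x3 refl = true≢false (trans (sym s3) ss)
        ds : Shallow 2 s c
        ds = dc s acs s≢x3
        go : (∃ λ ℓ → Adj T s ℓ × ℓ ≢ c) ⊎ LeafOf s c → InFamily T
        go (inj₂ lsc) = ⊥-elim (true≢false (trans (sym (proj₂ (leaf-in-support-out s c (sy _ _ acs) lsc))) ss))
        go (inj₁ (ℓ , asl , nℓ)) with other-neighbour₂ s c ℓ
        ... | inj₁ (ℓ′ , asl′ , m1 , m2) = reduce-O1 s ℓ ℓ′ asl asl′ (λ e → m2 (sym e)) (shallow⇒leaf (ds ℓ asl nℓ)) (shallow⇒leaf (ds ℓ′ asl′ m1))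
        ... | inj₂ ls = at-c s ℓ acs ss s≢x3 asl nℓ (shallow⇒leaf (ds ℓ asl nℓ)) ls (outside-neighbour c s)

    tail-case : TailT x0 x1 x2 x3
    tail-case l0 l1 l2 s3 s2F s1F with other-neighbour₂ x3 x2 x4
    ... | inj₂ l3 = reduce-O3 x0 x1 x2 x3 x4 a01 a12 a23 a34 l0 l1 l2 l3 unR (λ e → n04 (sym e)) (λ e → n14 (sym e)) (λ e → n24 (sym e)) s3
      where
      unR : Unique (x3 ∷ x2 ∷ x1 ∷ x0 ∷ [])
      unR = ((λ e → n23 (sym e)) ∷ (λ e → n13 (sym e)) ∷ (λ e → n03 (sym e)) ∷ []) ∷
            ((λ e → n12 (sym e)) ∷ (λ e → n02 (sym e)) ∷ []) ∷ ((λ e → n01 (sym e)) ∷ []) ∷ [] ∷ []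
    ... | inj₁ (c , ac , nc2 , nc4) = ViaBranch.result l0 l1 l2 s3 s2F s1F c ac nc2 nc4

  trail-head : ∀ x y r → Trail (x ∷ y ∷ r) → Adj T x y
  trail-head x y [] a = a
  trail-head x y (_ ∷ _) (a , _) = a

  -- The analysis of a locally maximal trail.  With 2 or 3 vertices, its middle
  -- is a star centre; with 4, the tail case is T ≅ P₄; with 5 or more, BeyondX3.
  analyse : ∀ P → Trail P → LocallyMaximal P → InFamily T
  analyse (x0 ∷ x1 ∷ []) nb (d0 , d1) = ⊥-elim (no-star x1 h)
    where
    h : ∀ y → Adj T x1 y → LeafOf y x1
    h y e with shallow⇒leaf d1 y e
    ... | refl = shallow⇒leaf d0
  analyse (x0 ∷ x1 ∷ x2 ∷ []) nb (d0 , d1 , d2) = ⊥-elim (no-star x1 h)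
    where
    h : ∀ y → Adj T x1 y → LeafOf y x1
    h y e with y ≟ x2
    ... | yes refl = shallow⇒leaf d2
    ... | no ne = shallow⇒leaf (d1 y e ne)
  analyse (x0 ∷ x1 ∷ x2 ∷ x3 ∷ []) nb (d0 , d1 , d2 , d3) with trail-unique _ nb
  ... | un@((n01 ∷ n02 ∷ n03 ∷ []) ∷ (n12 ∷ n13 ∷ []) ∷ (n23 ∷ []) ∷ [] ∷ []) =
    FromLeafEnd.result x0 x1 x2 x3 a01 a12 a23 n01 n02 n03 n12 n13 n23 d0 d1 d2
      (λ l0 l1 l2 _ _ _ → recognise-P4 x0 x1 x2 x3 a01 a12 a23 l0 l1 l2 (shallow⇒leaf d3) un)
    where
    a01 : Adj T x0 x1
    a01 = proj₁ nb
    a12 : Adj T x1 x2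
    a12 = proj₁ (proj₂ (proj₂ nb))
    a23 : Adj T x2 x3
    a23 = proj₂ (proj₂ (proj₂ (proj₂ nb)))
  analyse (x0 ∷ x1 ∷ x2 ∷ x3 ∷ x4 ∷ r) nb (d0 , d1 , d2 , d3) with trail-unique _ nb
  ... | (n01 ∷ n02 ∷ n03 ∷ n04 ∷ _) ∷ (n12 ∷ n13 ∷ n14 ∷ _) ∷ (n23 ∷ n24 ∷ _) ∷ _ =
    FromLeafEnd.result x0 x1 x2 x3 a01 a12 a23 n01 n02 n03 n12 n13 n23 d0 d1 d2
      (BeyondX3.tail-case x0 x1 x2 x3 x4 a01 a12 a23 a34 n01 n02 n03 n12 n13 n23 n04 n14 n24 d3)
    where
    a01 : Adj T x0 x1
    a01 = proj₁ nb
    a12 : Adj T x1 x2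
    a12 = proj₁ (proj₂ (proj₂ nb))
    a23 : Adj T x2 x3
    a23 = proj₁ (proj₂ (proj₂ (proj₂ (proj₂ nb))))
    a34 : Adj T x3 x4
    a34 = trail-head x3 x4 r (proj₂ (proj₂ (proj₂ (proj₂ (proj₂ (proj₂ nb))))))

inductive-step : ∀ N → InductionHypothesis N → FamilyIfGood N
inductive-step N IH T tree (S , good) with proj₂ (proj₂ good)
... | x , _ with proj₁ (proj₂ good) x
... | y , x~y , _ with Trails.locally-maximal-trail T (proj₁ tree) (proj₂ (proj₂ tree)) x y x~y
... | P , trail , maximal = CaseAnalysis.analyse T tree S good IH P trail maximal

goodMIS⇒family : ∀ {N} → FamilyIfGood N
goodMIS⇒family {N} = <-rec FamilyIfGood inductive-step N

-- The theorem: γ_{t,coi}(T) = n − β(T) says that T has a good set, which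
-- happens exactly for the trees of 𝒯.
theorem5 : ∀ {n} (T : Graph n) → IsTree T → DiamAtLeast3 T →
    ((Σ ℕ λ g → Σ ℕ λ b → IsGammaTCoI T g × IsBeta T b × g ≡ n ∸ b) ⇔ InFamily T)
theorem5 T tree _ = mk⇔
  (λ equality → goodMIS⇒family T tree (equality⇒goodMIS T equality))
  (λ family → goodMIS⇒equality T (family⇒goodMIS family))
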